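{- Let $\Gamma=\langle \alpha_1,\ldots,\alpha_k\rangle\subset\mathbb N^d$ be an affine semigroup with minimal generators $\alpha_1,\ldots,\alpha_k$, let $\mathbb K$ be a field, and let $\Gamma_H=\langle (1,0),(1,\alpha_1),\ldots,(1,\alpha_k)\rangle\subset\mathbb N^{d+1}$. Let $\mathrm I_{\Gamma_H}\subset\mathbb K[t,y_1,\ldots,y_k]$ be the kernel of the ring homomorphism $\mathbb K[t,y_1,\ldots,y_k]\to\mathbb K[s_0,s_1,\ldots,s_d]$ given by $t\mapsto s_0$ and $y_i\mapsto s_0 s^{\alpha_i}$. Let $G$ be a reduced Gröbner basis of $\mathrm I_{\Gamma_H}$ with respect to a lexicographic monomial order with $t>y_i$ for every $i\le k$. For $j\ge 0$ let $$I_j=\big\langle y^z-y^w : \gamma\in\Gamma,\ z,w\in\mathsf Z(\gamma),\ \big||w|-|z|\big|\le j\big\rangle\subset\mathbb K[y_1,\ldots,y_k]$$ and $$J_j=\big\langle y^z-y^w : i\in\mathbb N,\ z,w\in\mathbb N^k,\ t^iy^z-y^w\in G,\ i\le j\big\rangle.$$ Then $I_j=J_j$ for every $j\ge 0$.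
   Context: An affine semigroup is a finitely generated submonoid of $\mathbb N^d$, with unique minimal generating set $\alpha_1,\ldots,\alpha_k$. A factorization of $\gamma\in\Gamma$ is $z\in\mathbb N^k$ with $z_1\alpha_1+\cdots+z_k\alpha_k=\gamma$; $\mathsf Z(\gamma)$ denotes the set of factorizations, and $|z|=z_1+\cdots+z_k$. For $z\in\mathbb N^k$, $y^z=y_1^{z_1}\cdots y_k^{z_k}$, and for $\alpha\in\mathbb N^d$, $s^{\alpha}=s_1^{\alpha_1}\cdots s_d^{\alpha_d}$. -}

module Defs where

open import Level using (Level; _⊔_)
open import Algebra.Bundles using (CommutativeRing)
open import Data.Nat as ℕ using (ℕ; zero; suc; _≤_; _<_; ∣_-_∣)
open import Data.Fin using (Fin)
open import Data.Fin.Permutation using (Permutation′; _⟨$⟩ʳ_)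
open import Data.Vec as V using (Vec; []; _∷_; lookup; tabulate; replicate; zipWith)
open import Data.Vec.Properties using (≡-dec)
open import Data.Vec.Relation.Binary.Pointwise.Inductive using (Pointwise)
open import Data.List as L using (List; []; _∷_; _++_; foldr; concatMap; length)
open import Data.List.Relation.Unary.All using (All)
open import Data.Product using (Σ; ∃; _×_; _,_; proj₁; proj₂)
open import Relation.Nullary using (¬_; yes; no)
open import Relation.Binary.PropositionalEquality using (_≡_; _≢_)

record Field (c ℓ : Level) : Set (Level.suc (c ⊔ ℓ)) where
  field
    commutativeRing : CommutativeRing c ℓ
  open CommutativeRing commutativeRing public
  field
    1≉0     : ¬ (1# ≈ 0#)
    inverse : ∀ x → ¬ (x ≈ 0#) → Σ Carrier λ y → x * y ≈ 1#

Monomial : ℕ → Set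
Monomial n = Vec ℕ n

∣_∣ₘ : ∀ {n} → Monomial n → ℕ
∣ z ∣ₘ = V.sum z

lincomb : ∀ {k d} → Vec ℕ k → Vec (Vec ℕ d) k → Vec ℕ d
lincomb {d = d} []       []       = replicate d 0
lincomb         (z ∷ zs) (a ∷ as) = zipWith ℕ._+_ (V.map (z ℕ.*_) a) (lincomb zs as)

IsFactorization : ∀ {k d} → Vec (Vec ℕ d) k → Vec ℕ k → Vec ℕ d → Set
IsFactorization α z γ = lincomb z α ≡ γ

MinimalGenerators : ∀ {k d} → Vec (Vec ℕ d) k → Set
MinimalGenerators {k} α =
  ∀ (i : Fin k) → ¬ (Σ (Vec ℕ k) λ z → (lookup z i ≡ 0) × (lincomb z α ≡ lookup α i))

_∣ₘ_ : ∀ {n} → Monomial n → Monomial n → Set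
m ∣ₘ m' = Pointwise _≤_ m m'

data _<lex_ : ∀ {n} → Monomial n → Monomial n → Set where
  here  : ∀ {n a b} {u v : Monomial n} → a < b → (a ∷ u) <lex (b ∷ v)
  there : ∀ {n a} {u v : Monomial n} → u <lex v → (a ∷ u) <lex (a ∷ v)

-- Variables of K[t,y₁,…,yₖ] are indexed by Fin (suc k): index 0 is t,
-- index (suc i) is y_{i+1}.  A lexicographic order with t > yᵢ for all i
-- is given by a permutation σ of the y-variables: the variable order is
-- t > y_{σ 0} > y_{σ 1} > ⋯ > y_{σ (k-1)}.
reorder : ∀ {k} → Permutation′ k → Monomial (suc k) → Monomial (suc k)
reorder σ (e ∷ es) = e ∷ tabulate (λ i → lookup es (σ ⟨$⟩ʳ i))

LexOrder : ∀ {k} → Permutation′ k → Monomial (suc k) → Monomial (suc k) → Set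
LexOrder σ m m' = reorder σ m <lex reorder σ m'

-- Polynomials over a field, as finite lists of terms (coefficient,
-- exponent vector); equality is equality of all coefficients.

module _ {c ℓ} (K : Field c ℓ) where
  open Field K

  Poly : ℕ → Set c
  Poly n = List (Carrier × Monomial n)

  coeff : ∀ {n} → Poly n → Monomial n → Carrier
  coeff []            m = 0#
  coeff ((a , u) ∷ p) m with ≡-dec ℕ._≟_ u m
  ... | yes _ = a + coeff p m
  ... | no  _ = coeff p m

  _≈ₚ_ : ∀ {n} → Poly n → Poly n → Set ℓ
  p ≈ₚ q = ∀ m → coeff p m ≈ coeff q m

  0ₚ : ∀ {n} → Poly n
  0ₚ = []

  _+ₚ_ : ∀ {n} → Poly n → Poly n → Poly n
  p +ₚ q = p ++ q

  _*ₚ_ : ∀ {n} → Poly n → Poly n → Poly n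
  p *ₚ q = concatMap (λ { (a , u) → L.map (λ { (b , v) → (a * b , zipWith ℕ._+_ u v) }) q }) p

  binomial : ∀ {n} → Monomial n → Monomial n → Poly n
  binomial u v = (1# , u) ∷ (- 1# , v) ∷ []

  InIdeal : ∀ {n ℓ'} → (Poly n → Set ℓ') → Poly n → Set (c ⊔ ℓ ⊔ ℓ')
  InIdeal {n} S f =
    Σ (List (Poly n × Poly n)) λ l →
      All (λ hg → S (proj₂ hg)) l ×
      f ≈ₚ foldr (λ hg acc → (proj₁ hg *ₚ proj₂ hg) +ₚ acc) 0ₚ l

  SameIdeal : ∀ {n ℓ₁ ℓ₂} → (Poly n → Set ℓ₁) → (Poly n → Set ℓ₂) → Set (c ⊔ ℓ ⊔ ℓ₁ ⊔ ℓ₂)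
  SameIdeal S T = ∀ f → (InIdeal S f → InIdeal T f) × (InIdeal T f → InIdeal S f)

  -- The homogenized toric ideal I_{Γ_H} ⊂ K[t,y₁,…,yₖ]: kernel of
  -- t ↦ s₀, yᵢ ↦ s₀ s^{αᵢ}, into K[s₀,s₁,…,s_d].
  -- A monomial t^e y^z is sent to s₀^{e+|z|} s^{Σ zᵢαᵢ}.
  phiMon : ∀ {k d} → Vec (Vec ℕ d) k → Monomial (suc k) → Monomial (suc d)
  phiMon α (e ∷ z) = (e ℕ.+ ∣ z ∣ₘ) ∷ lincomb z α

  phi : ∀ {k d} → Vec (Vec ℕ d) k → Poly (suc k) → Poly (suc d)
  phi α = L.map (λ { (a , u) → (a , phiMon α u) })

  ToricIdealH : ∀ {k d} → Vec (Vec ℕ d) k → Poly (suc k) → Set ℓ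
  ToricIdealH α f = phi α f ≈ₚ 0ₚ

  IsLeadingMonomial : ∀ {n} → (Monomial n → Monomial n → Set) → Poly n → Monomial n → Set ℓ
  IsLeadingMonomial _≺_ f m = ¬ (coeff f m ≈ 0#) × (∀ m' → m ≺ m' → coeff f m' ≈ 0#)

  IsGroebnerBasis : ∀ {n ℓ'} → (Monomial n → Monomial n → Set) →
                    (Poly n → Set ℓ') → List (Poly n) → Set (c ⊔ ℓ ⊔ ℓ')
  IsGroebnerBasis _≺_ I G =
    All I G ×
    (∀ f → I f → ¬ (f ≈ₚ 0ₚ) →
      Σ (Fin (length G)) λ p → Σ (Monomial _) λ mg → Σ (Monomial _) λ mf →
        IsLeadingMonomial _≺_ (L.lookup G p) mg × IsLeadingMonomial _≺_ f mf × (mg ∣ₘ mf))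

  IsReducedGroebnerBasis : ∀ {n ℓ'} → (Monomial n → Monomial n → Set) →
                           (Poly n → Set ℓ') → List (Poly n) → Set (c ⊔ ℓ ⊔ ℓ')
  IsReducedGroebnerBasis _≺_ I G =
    IsGroebnerBasis _≺_ I G ×
    (∀ p → Σ (Monomial _) λ m → IsLeadingMonomial _≺_ (L.lookup G p) m × (coeff (L.lookup G p) m ≈ 1#)) ×
    (∀ p q → p ≢ q → ∀ mq → IsLeadingMonomial _≺_ (L.lookup G q) mq →
      ∀ m → ¬ (coeff (L.lookup G p) m ≈ 0#) → ¬ (mq ∣ₘ m))

  IGen : ∀ {k d} → Vec (Vec ℕ d) k → ℕ → Poly k → Set c
  IGen {k} {d} α j f =
    Σ (Vec ℕ d) λ γ → Σ (Monomial k) λ z → Σ (Monomial k) λ w →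
      IsFactorization α z γ × IsFactorization α w γ ×
      (∣ ∣ w ∣ₘ - ∣ z ∣ₘ ∣ ≤ j) × (f ≡ binomial z w)

  JGen : ∀ {k} → List (Poly (suc k)) → ℕ → Poly k → Set (c ⊔ ℓ)
  JGen {k} G j f =
    Σ ℕ λ i → Σ (Monomial k) λ z → Σ (Monomial k) λ w →
      (i ≤ j) ×
      (Σ (Fin (length G)) λ p → L.lookup G p ≈ₚ binomial (i ∷ z) (0 ∷ w)) ×
      (f ≡ binomial z w)

module Submission where

open import Defs
open import Level using (_⊔_)
open import Data.Nat using (ℕ; suc)
open import Data.Vec using (Vec)
open import Data.List using (List)
open import Data.Fin.Permutation using (Permutation′)

import Data.Nat as ℕ
import Data.Nat.Properties as ℕP
import Data.Nat.Induction as ℕI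
open import Data.Nat using (zero; _≤_; _<_; z≤n; s≤s; ∣_-_∣)
open import Data.Nat.Tactic.RingSolver using (solve-∀)
open import Data.Fin using (Fin)
import Data.Fin.Properties as FP
open import Data.Fin.Permutation using (_⟨$⟩ʳ_; _⟨$⟩ˡ_; inverseʳ)
open import Data.Vec as V using ([]; _∷_; zipWith; lookup; tabulate; replicate)
import Data.Vec.Properties as VP
open import Data.Vec.Relation.Binary.Pointwise.Inductive as PW using ([]; _∷_)
open import Data.List as L using ([]; _∷_; _++_; foldr; filter; length)
import Data.List.Properties as LP
open import Data.List.Relation.Unary.All as All using (All; []; _∷_)
import Data.List.Relation.Unary.All.Properties as AllP
open import Data.List.Relation.Unary.Any as Any using (here)
open import Data.List.Membership.Propositional.Properties using (∈-lookup)
open import Data.Product using (Σ; _×_; _,_; proj₁; proj₂)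
open import Data.Sum using (_⊎_; inj₁; inj₂)
open import Data.Empty using (⊥-elim)
open import Relation.Nullary using (¬_; Dec; yes; no; ¬?; _×-dec_)
open import Relation.Unary using (Decidable)
open import Relation.Unary.Properties using (∁?)
open import Relation.Binary.Definitions using (tri<; tri≈; tri>)
open import Relation.Binary.PropositionalEquality as ≡ using (_≡_; _≢_)
open import Induction.WellFounded using (WellFounded; Acc; acc)
import Relation.Binary.Construct.On as On

-- From the
-- Gröbner basis property: standard monomials have distinct images
-- (standard-unique), every monomial has a standard normal form
-- (normal-form), and every element of G is t^i y^z − y^w with leading
-- term t^i y^z (generator-shape).  Finally J_j ⊆ I_j because such a
-- binomial lies in I (J⊆I), and I_j ⊆ J_j because for factorizations z, w
-- with |z| ≤ |w| the monomials t^{|w|−|z|} y^z and y^w share a normal form,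
-- and reducing to it by steps t^i y^z ↦ y^w with i ≤ j links y^z and y^w
-- inside ⟨J_j⟩ (linked-to-normal-form, factorizations-linked).

-- Monomials x^u are exponent vectors u ∈ ℕⁿ; multiplication of monomials
-- is addition of exponents, and for u ∣ₘ m the quotient is m ⊖ u.

infixl 6 _⊕_ _⊖_

_⊕_ : ∀ {n} → Monomial n → Monomial n → Monomial n
_⊕_ = zipWith ℕ._+_

_⊖_ : ∀ {n} → Monomial n → Monomial n → Monomial n
_⊖_ = zipWith ℕ._∸_

𝟙 : ∀ {n} → Monomial n
𝟙 {n} = replicate n 0

⊕-comm : ∀ {n} (u v : Monomial n) → u ⊕ v ≡ v ⊕ u
⊕-comm u v = PW.Pointwise-≡⇒≡ (PW.zipWith-comm ℕP.+-comm u v)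

⊕-identityˡ : ∀ {n} (u : Monomial n) → 𝟙 ⊕ u ≡ u
⊕-identityˡ u = PW.Pointwise-≡⇒≡ (PW.zipWith-identityˡ ℕP.+-identityˡ u)

⊕-identityʳ : ∀ {n} (u : Monomial n) → u ⊕ 𝟙 ≡ u
⊕-identityʳ u = PW.Pointwise-≡⇒≡ (PW.zipWith-identityʳ ℕP.+-identityʳ u)

+-exchange : ∀ a b c d → (a ℕ.+ b) ℕ.+ (c ℕ.+ d) ≡ (a ℕ.+ c) ℕ.+ (b ℕ.+ d)
+-exchange = solve-∀

⊕-exchange : ∀ {n} (a b c d : Monomial n) → (a ⊕ b) ⊕ (c ⊕ d) ≡ (a ⊕ c) ⊕ (b ⊕ d)
⊕-exchange [] [] [] [] = ≡.refl
⊕-exchange (a ∷ as) (b ∷ bs) (c ∷ cs) (d ∷ ds) =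
  ≡.cong₂ _∷_ (+-exchange a b c d) (⊕-exchange as bs cs ds)

∣ₘ? : ∀ {n} (u m : Monomial n) → Dec (u ∣ₘ m)
∣ₘ? = PW.decidable ℕ._≤?_

∣ₘ-refl : ∀ {n} {u : Monomial n} → u ∣ₘ u
∣ₘ-refl = PW.refl ℕP.≤-refl

∣ₘ-trans : ∀ {n} {u v w : Monomial n} → u ∣ₘ v → v ∣ₘ w → u ∣ₘ w
∣ₘ-trans = PW.trans ℕP.≤-trans

∣ₘ-⊕ : ∀ {n} (u v : Monomial n) → u ∣ₘ (u ⊕ v)
∣ₘ-⊕ [] [] = []
∣ₘ-⊕ (a ∷ u) (b ∷ v) = ℕP.m≤m+n a b ∷ ∣ₘ-⊕ u v

⊕-⊖ : ∀ {n} {u m : Monomial n} → u ∣ₘ m → u ⊕ (m ⊖ u) ≡ m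
⊕-⊖ [] = ≡.refl
⊕-⊖ (a≤b ∷ u∣m) = ≡.cong₂ _∷_ (ℕP.m+[n∸m]≡n a≤b) (⊕-⊖ u∣m)

⊖-⊕ : ∀ {n} {u m : Monomial n} → u ∣ₘ m → (m ⊖ u) ⊕ u ≡ m
⊖-⊕ {u = u} {m} u∣m = ≡.trans (⊕-comm (m ⊖ u) u) (⊕-⊖ u∣m)

⊕-⊖-cancel : ∀ {n} (u v : Monomial n) → (u ⊕ v) ⊖ u ≡ v
⊕-⊖-cancel [] [] = ≡.refl
⊕-⊖-cancel (a ∷ u) (b ∷ v) = ≡.cong₂ _∷_ (ℕP.m+n∸m≡n a b) (⊕-⊖-cancel u v)

⊖-⊕-assoc : ∀ {n} (m u v : Monomial n) → m ⊖ (u ⊕ v) ≡ (m ⊖ u) ⊖ v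
⊖-⊕-assoc [] [] [] = ≡.refl
⊖-⊕-assoc (a ∷ m) (b ∷ u) (c ∷ v) = ≡.cong₂ _∷_ (≡.sym (ℕP.∸-+-assoc a b c)) (⊖-⊕-assoc m u v)

t∣ : ∀ {n} e (z : Monomial n) → (e ∷ z) ∣ₘ (suc e ∷ z)
t∣ e z = ℕP.n≤1+n e ∷ ∣ₘ-refl

∣ₘ-⊖ : ∀ {n} {u v m : Monomial n} → (u ⊕ v) ∣ₘ m → v ∣ₘ (m ⊖ u)
∣ₘ-⊖ {u = []} {[]} {[]} [] = []
∣ₘ-⊖ {u = a ∷ u} {b ∷ v} {c ∷ m} (a+b≤c ∷ uv∣m) =
  ℕP.m+n≤o⇒m≤o∸n b (≡.subst (ℕ._≤ c) (ℕP.+-comm a b) a+b≤c) ∷ ∣ₘ-⊖ uv∣m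

∣ₘ-⊕⁺ : ∀ {n} {u v m : Monomial n} → u ∣ₘ m → v ∣ₘ (m ⊖ u) → (u ⊕ v) ∣ₘ m
∣ₘ-⊕⁺ {u = []} {[]} {[]} [] [] = []
∣ₘ-⊕⁺ {u = a ∷ u} {b ∷ v} {c ∷ m} (a≤c ∷ u∣m) (b≤c∸a ∷ v∣m⊖u) =
  ≡.subst (a ℕ.+ b ℕ.≤_) (ℕP.m+[n∸m]≡n a≤c) (ℕP.+-monoʳ-≤ a b≤c∸a) ∷ ∣ₘ-⊕⁺ u∣m v∣m⊖u

⊖≡𝟙⇔≡ : ∀ {n} {u m : Monomial n} → u ∣ₘ m → (𝟙 ≡ m ⊖ u → u ≡ m) × (u ≡ m → 𝟙 ≡ m ⊖ u)
⊖≡𝟙⇔≡ {u = u} {m} u∣m =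
  (λ e → ≡.trans (≡.sym (⊕-identityʳ u)) (≡.trans (≡.cong (u ⊕_) e) (⊕-⊖ u∣m))) ,
  (λ { ≡.refl → ≡.sym (≡.trans (≡.cong (_⊖ u) (≡.sym (⊕-identityʳ u))) (⊕-⊖-cancel u 𝟙)) })

lex-irrefl : ∀ {n} {u : Monomial n} → ¬ (u <lex u)
lex-irrefl (here a<a) = ℕP.<-irrefl ≡.refl a<a
lex-irrefl (there u<u) = lex-irrefl u<u

lex-trans : ∀ {n} {u v w : Monomial n} → u <lex v → v <lex w → u <lex w
lex-trans (here a<b) (here b<c) = here (ℕP.<-trans a<b b<c)
lex-trans (here a<b) (there _) = here a<b
lex-trans (there _) (here b<c) = here b<c
lex-trans (there u<v) (there v<w) = there (lex-trans u<v v<w)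

lex-total : ∀ {n} (u v : Monomial n) → u ≢ v → u <lex v ⊎ v <lex u
lex-total [] [] u≢v = ⊥-elim (u≢v ≡.refl)
lex-total (a ∷ u) (b ∷ v) au≢bv with ℕP.<-cmp a b
... | tri< a<b _ _ = inj₁ (here a<b)
... | tri> _ _ b<a = inj₂ (here b<a)
... | tri≈ _ ≡.refl _ with lex-total u v (λ u≡v → au≢bv (≡.cong (a ∷_) u≡v))
...   | inj₁ u<v = inj₁ (there u<v)
...   | inj₂ v<u = inj₂ (there v<u)

lex? : ∀ {n} (u v : Monomial n) → Dec (u <lex v)
lex? [] [] = no λ ()
lex? (a ∷ u) (b ∷ v) with ℕP.<-cmp a b
... | tri< a<b _ _ = yes (here a<b)
... | tri> a≮b a≢b _ = no λ { (here a<b) → a≮b a<b ; (there _) → a≢b ≡.refl }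
... | tri≈ a≮b ≡.refl _ with lex? u v
...   | yes u<v = yes (there u<v)
...   | no u≮v = no λ { (here a<a) → a≮b a<a ; (there u<v) → u≮v u<v }

lex-⊕ : ∀ {n} (w : Monomial n) {u v : Monomial n} → u <lex v → (w ⊕ u) <lex (w ⊕ v)
lex-⊕ (c ∷ w) (here a<b) = here (ℕP.+-monoʳ-< c a<b)
lex-⊕ (c ∷ w) (there u<v) = there (lex-⊕ w u<v)

lex-𝟙 : ∀ {n} (u : Monomial n) → 𝟙 ≡ u ⊎ 𝟙 <lex u
lex-𝟙 [] = inj₁ ≡.refl
lex-𝟙 (zero ∷ u) with lex-𝟙 u
... | inj₁ 𝟙≡u = inj₁ (≡.cong (0 ∷_) 𝟙≡u)
... | inj₂ 𝟙<u = inj₂ (there 𝟙<u)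
lex-𝟙 (suc a ∷ u) = inj₂ (here (s≤s z≤n))

lex-wellFounded : ∀ n → WellFounded (_<lex_ {n})
lex-wellFounded zero [] = acc λ ()
lex-wellFounded (suc n) (a ∷ u) = acc (below a (ℕI.<-wellFounded a) u (lex-wellFounded n u))
  where
  -- nested induction: first on the leading exponent, then on the tail
  below : ∀ a → Acc _<_ a → ∀ u → Acc _<lex_ u → ∀ {v} → v <lex (a ∷ u) → Acc _<lex_ v
  below a (acc rs) u _ (here b<a) = acc (below _ (rs b<a) _ (lex-wellFounded n _))
  below a a-acc u (acc rs) (there v<u) = acc (below a a-acc _ (rs v<u))

shiftT : ∀ {n} → ℕ → Monomial (suc n) → Monomial (suc n)
shiftT T (e ∷ z) = (T ℕ.+ e) ∷ z

shiftT-injective : ∀ {n} T {x y : Monomial (suc n)} → shiftT T x ≡ shiftT T y → x ≡ y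
shiftT-injective T {e ∷ z} {f ∷ w} eq with VP.∷-injective eq
... | T+e≡T+f , ≡.refl = ≡.cong (_∷ z) (ℕP.+-cancelˡ-≡ T e f T+e≡T+f)

shiftT-low : ∀ {n} T (x y : Monomial (suc n)) → V.head y < T → shiftT T x ≢ y
shiftT-low T (e ∷ z) (f ∷ w) f<T eq = ℕP.<⇒≱ f<T (≡.subst (T ℕ.≤_) (VP.∷-injectiveˡ eq) (ℕP.m≤m+n T e))

shiftT-high : ∀ {n} T (y : Monomial (suc n)) → T ≤ V.head y → Σ (Monomial (suc n)) λ x → shiftT T x ≡ y
shiftT-high T (f ∷ w) T≤f = (f ℕ.∸ T) ∷ w , ≡.cong (_∷ w) (ℕP.m+[n∸m]≡n T≤f)

module MonomialOrder {k : ℕ} (σ : Permutation′ k) where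

  infix 4 _≺_
  _≺_ : Monomial (suc k) → Monomial (suc k) → Set
  _≺_ = LexOrder σ

  private
    ro : Monomial (suc k) → Monomial (suc k)
    ro = reorder σ

    lookup-ext : ∀ {n} {u v : Vec ℕ n} → (∀ i → lookup u i ≡ lookup v i) → u ≡ v
    lookup-ext {u = u} {v} eq =
      ≡.trans (≡.sym (VP.tabulate∘lookup u)) (≡.trans (VP.tabulate-cong eq) (VP.tabulate∘lookup v))

    lookup-ro : ∀ e es i → lookup (V.tail (ro (e ∷ es))) i ≡ lookup es (σ ⟨$⟩ʳ i)
    lookup-ro e es i = VP.lookup∘tabulate (λ j → lookup es (σ ⟨$⟩ʳ j)) i

    lookup-⊕ : ∀ {n} (u v : Monomial n) i → lookup (u ⊕ v) i ≡ lookup u i ℕ.+ lookup v i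
    lookup-⊕ u v i = VP.lookup-zipWith ℕ._+_ i u v

    ro-⊕ : ∀ (M N : Monomial (suc k)) → ro (M ⊕ N) ≡ ro M ⊕ ro N
    ro-⊕ (e ∷ es) (f ∷ fs) = ≡.cong ((e ℕ.+ f) ∷_) (lookup-ext λ i →
      ≡.trans (lookup-ro (e ℕ.+ f) (es ⊕ fs) i) (≡.trans (lookup-⊕ es fs (σ ⟨$⟩ʳ i))
        (≡.sym (≡.trans (lookup-⊕ (V.tail (ro (e ∷ es))) (V.tail (ro (f ∷ fs))) i)
          (≡.cong₂ ℕ._+_ (lookup-ro e es i) (lookup-ro f fs i))))))

    ro-𝟙 : ro 𝟙 ≡ 𝟙
    ro-𝟙 = ≡.cong (0 ∷_) (lookup-ext λ i →
      ≡.trans (lookup-ro 0 𝟙 i) (≡.trans (VP.lookup-replicate (σ ⟨$⟩ʳ i) 0) (≡.sym (VP.lookup-replicate i 0))))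

    ro-injective : ∀ {M N : Monomial (suc k)} → ro M ≡ ro N → M ≡ N
    ro-injective {e ∷ es} {f ∷ fs} eq with VP.∷-injective eq
    ... | ≡.refl , tails≡ = ≡.cong (e ∷_) (lookup-ext λ j →
      ≡.subst (λ i → lookup es i ≡ lookup fs i) (inverseʳ σ) (entries≡ (σ ⟨$⟩ˡ j)))
      where
      entries≡ : ∀ i → lookup es (σ ⟨$⟩ʳ i) ≡ lookup fs (σ ⟨$⟩ʳ i)
      entries≡ i = ≡.trans (≡.sym (lookup-ro e es i))
        (≡.trans (≡.cong (λ v → lookup v i) tails≡) (lookup-ro e fs i))

  ≺-irrefl : ∀ {M} → ¬ (M ≺ M)
  ≺-irrefl = lex-irrefl

  ≺-trans : ∀ {M N P} → M ≺ N → N ≺ P → M ≺ P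
  ≺-trans = lex-trans

  ≺-total : ∀ M N → M ≢ N → M ≺ N ⊎ N ≺ M
  ≺-total M N M≢N = lex-total (ro M) (ro N) (λ e → M≢N (ro-injective e))

  ≺? : ∀ M N → Dec (M ≺ N)
  ≺? M N = lex? (ro M) (ro N)

  ≺-⊕ : ∀ W {M N} → M ≺ N → (W ⊕ M) ≺ (W ⊕ N)
  ≺-⊕ W {M} {N} M≺N = ≡.subst₂ _<lex_ (≡.sym (ro-⊕ W M)) (≡.sym (ro-⊕ W N)) (lex-⊕ (ro W) M≺N)

  ∣ₘ⇒≼ : ∀ {M N} → M ∣ₘ N → M ≡ N ⊎ M ≺ N
  ∣ₘ⇒≼ {M} {N} M∣N with lex-𝟙 (ro (N ⊖ M))
  ... | inj₁ 𝟙≡ = inj₁ (≡.trans (≡.sym (⊕-identityʳ M))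
                   (≡.trans (≡.cong (M ⊕_) (ro-injective (≡.trans ro-𝟙 𝟙≡))) (⊕-⊖ M∣N)))
  ... | inj₂ 𝟙< = inj₂ (≡.subst₂ _<lex_ (⊕-identityʳ (ro M))
                   (≡.trans (≡.sym (ro-⊕ M (N ⊖ M))) (≡.cong ro (⊕-⊖ M∣N))) (lex-⊕ (ro M) 𝟙<))

  ≺-wellFounded : WellFounded _≺_
  ≺-wellFounded = On.wellFounded ro (lex-wellFounded (suc k))

  ≺-byT : ∀ {e f u v} → e < f → (e ∷ u) ≺ (f ∷ v)
  ≺-byT e<f = here e<f

  ≺-shiftT : ∀ T {x} (y : Monomial (suc k)) → V.head x < T → x ≺ shiftT T y
  ≺-shiftT T {e ∷ _} (f ∷ _) e<T = here (ℕP.<-≤-trans e<T (ℕP.m≤m+n T f))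

∣i+m-m∣≡i : ∀ i m → ∣ i ℕ.+ m - m ∣ ≡ i
∣i+m-m∣≡i i m =
  ≡.trans (≡.cong ∣_- m ∣ (ℕP.+-comm i m)) (≡.trans (ℕP.∣-∣-comm (m ℕ.+ i) m) (ℕP.∣m-m+n∣≡n m i))

∣⊕∣ : ∀ {n} (z w : Monomial n) → ∣ z ⊕ w ∣ₘ ≡ ∣ z ∣ₘ ℕ.+ ∣ w ∣ₘ
∣⊕∣ [] [] = ≡.refl
∣⊕∣ (a ∷ z) (b ∷ w) = ≡.trans (≡.cong ((a ℕ.+ b) ℕ.+_) (∣⊕∣ z w)) (+-exchange a b ∣ z ∣ₘ ∣ w ∣ₘ)

lincomb-⊕ : ∀ {k d} (z w : Vec ℕ k) (α : Vec (Vec ℕ d) k) →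
            lincomb (z ⊕ w) α ≡ lincomb z α ⊕ lincomb w α
lincomb-⊕ [] [] [] = ≡.sym (⊕-identityʳ 𝟙)
lincomb-⊕ (a ∷ z) (b ∷ w) (γ ∷ α) =
  ≡.trans (≡.cong₂ _⊕_ (scale-+ γ) (lincomb-⊕ z w α))
          (⊕-exchange (V.map (a ℕ.*_) γ) (V.map (b ℕ.*_) γ) (lincomb z α) (lincomb w α))
  where
  scale-+ : ∀ {d} (γ : Vec ℕ d) → V.map ((a ℕ.+ b) ℕ.*_) γ ≡ V.map (a ℕ.*_) γ ⊕ V.map (b ℕ.*_) γ
  scale-+ [] = ≡.refl
  scale-+ (x ∷ γ) = ≡.cong₂ _∷_ (ℕP.*-distribʳ-+ x a b) (scale-+ γ)

-- Polynomials are lists of terms, so the same polynomial has many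
-- representations.  All reasoning goes through coefficients: the
-- coefficient of S in the image of p under a map F of monomials is
-- coeffAlong F p S = Σ { a | (a , M) ∈ p , F M = S }, and coef p = coeffAlong id p.

module Coefficients {c ℓ} (K : Field c ℓ) where
  open Field K hiding (zero)
  open import Relation.Binary.Reasoning.Setoid setoid
  open import Algebra.Properties.Ring ring using (-1*x≈-x)
  open import Algebra.Properties.AbelianGroup +-abelianGroup
    using (ε⁻¹≈ε; ⁻¹-involutive; ⁻¹-∙-comm)

  -1≉0 : ¬ (- 1# ≈ 0#)
  -1≉0 -1≈0 = 1≉0 (trans (sym (⁻¹-involutive 1#)) (trans (-‿cong -1≈0) ε⁻¹≈ε))

  +-exchangeᴷ : ∀ x y z w → (x + y) + (z + w) ≈ (x + z) + (y + w)
  +-exchangeᴷ x y z w = begin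
    (x + y) + (z + w) ≈⟨ +-assoc x y (z + w) ⟩
    x + (y + (z + w)) ≈⟨ +-congˡ (sym (+-assoc y z w)) ⟩
    x + ((y + z) + w) ≈⟨ +-congˡ (+-congʳ (+-comm y z)) ⟩
    x + ((z + y) + w) ≈⟨ +-congˡ (+-assoc z y w) ⟩
    x + (z + (y + w)) ≈⟨ sym (+-assoc x z (y + w)) ⟩
    (x + z) + (y + w) ∎

  +-vanishˡ : ∀ {x y} → x + y ≈ 0# → x ≈ 0# → y ≈ 0#
  +-vanishˡ {x} {y} x+y≈0 x≈0 = trans (sym (trans (+-congʳ x≈0) (+-identityˡ y))) x+y≈0

  +-vanishʳ : ∀ {x y} → x + y ≈ 0# → y ≈ 0# → x ≈ 0#
  +-vanishʳ x+y≈0 y≈0 = +-vanishˡ (trans (+-comm _ _) x+y≈0) y≈0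

  δ : ∀ {n} → Monomial n → Monomial n → Carrier
  δ u m with VP.≡-dec ℕ._≟_ u m
  ... | yes _ = 1#
  ... | no _ = 0#

  δ-≡ : ∀ {n} {u m : Monomial n} → u ≡ m → δ u m ≡ 1#
  δ-≡ {u = u} {m} u≡m with VP.≡-dec ℕ._≟_ u m
  ... | yes _ = ≡.refl
  ... | no u≢m = ⊥-elim (u≢m u≡m)

  δ-≢ : ∀ {n} {u m : Monomial n} → u ≢ m → δ u m ≡ 0#
  δ-≢ {u = u} {m} u≢m with VP.≡-dec ℕ._≟_ u m
  ... | yes u≡m = ⊥-elim (u≢m u≡m)
  ... | no _ = ≡.refl

  δ-injective : ∀ {n n'} (f : Monomial n → Monomial n') → (∀ {x y} → f x ≡ f y → x ≡ y) →
                ∀ u v → δ (f u) (f v) ≡ δ u v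
  δ-injective f f-inj u v with VP.≡-dec ℕ._≟_ u v
  ... | yes u≡v = δ-≡ (≡.cong f u≡v)
  ... | no u≢v = δ-≢ (λ e → u≢v (f-inj e))

  coeffAlong : ∀ {n n'} → (Monomial n → Monomial n') → Poly K n → Monomial n' → Carrier
  coeffAlong F [] S = 0#
  coeffAlong F ((a , M) ∷ p) S = a * δ (F M) S + coeffAlong F p S

  coef : ∀ {n} → Poly K n → Monomial n → Carrier
  coef = coeffAlong (λ M → M)

  infix 4 _≋_
  _≋_ : ∀ {n} → Poly K n → Poly K n → Set ℓ
  p ≋ q = ∀ m → coef p m ≈ coef q m

  coeff≈coef : ∀ {n} (p : Poly K n) m → coeff K p m ≈ coef p m
  coeff≈coef [] m = refl
  coeff≈coef ((a , u) ∷ p) m with VP.≡-dec ℕ._≟_ u m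
  ... | yes _ = +-cong (sym (*-identityʳ a)) (coeff≈coef p m)
  ... | no _ = trans (coeff≈coef p m) (sym (trans (+-congʳ (zeroʳ a)) (+-identityˡ _)))

  ≈ₚ⇒≋ : ∀ {n} (p q : Poly K n) → _≈ₚ_ K p q → p ≋ q
  ≈ₚ⇒≋ p q p≈q m = trans (sym (coeff≈coef p m)) (trans (p≈q m) (coeff≈coef q m))

  ≋⇒≈ₚ : ∀ {n} (p q : Poly K n) → p ≋ q → _≈ₚ_ K p q
  ≋⇒≈ₚ p q p≋q m = trans (coeff≈coef p m) (trans (p≋q m) (sym (coeff≈coef q m)))

  coeff-phi : ∀ {k d} (α : Vec (Vec ℕ d) k) (p : Poly K (suc k)) S →
              coeff K (phi K α p) S ≈ coeffAlong (phiMon K α) p S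
  coeff-phi α [] S = refl
  coeff-phi α ((a , u) ∷ p) S with VP.≡-dec ℕ._≟_ (phiMon K α u) S
  ... | yes _ = +-cong (sym (*-identityʳ a)) (coeff-phi α p S)
  ... | no _ = trans (coeff-phi α p S) (sym (trans (+-congʳ (zeroʳ a)) (+-identityˡ _)))

  coeffAlong-++ : ∀ {n n'} (F : Monomial n → Monomial n') p q S →
                  coeffAlong F (p ++ q) S ≈ coeffAlong F p S + coeffAlong F q S
  coeffAlong-++ F [] q S = sym (+-identityˡ _)
  coeffAlong-++ F ((a , M) ∷ p) q S = trans (+-congˡ (coeffAlong-++ F p q S)) (sym (+-assoc _ _ _))

  coef-++ : ∀ {n} (p q : Poly K n) m → coef (p ++ q) m ≈ coef p m + coef q m
  coef-++ = coeffAlong-++ (λ M → M)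

  coeffAlong-agree : ∀ {n n₁ n₂} (F : Monomial n → Monomial n₁) (F' : Monomial n → Monomial n₂) S S' p →
    All (λ e → δ (F (proj₂ e)) S ≡ δ (F' (proj₂ e)) S') p → coeffAlong F p S ≡ coeffAlong F' p S'
  coeffAlong-agree F F' S S' [] [] = ≡.refl
  coeffAlong-agree F F' S S' ((a , M) ∷ p) (e ∷ es) =
    ≡.cong₂ (λ x y → a * x + y) e (coeffAlong-agree F F' S S' p es)

  coeffAlong-vanish : ∀ {n n'} (F : Monomial n → Monomial n') S p →
    All (λ e → F (proj₂ e) ≢ S) p → coeffAlong F p S ≈ 0#
  coeffAlong-vanish F S [] [] = refl
  coeffAlong-vanish F S ((a , M) ∷ p) (FM≢S ∷ es) = begin
    a * δ (F M) S + coeffAlong F p S ≈⟨ +-cong (reflexive (≡.cong (a *_) (δ-≢ FM≢S))) (coeffAlong-vanish F S p es) ⟩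
    a * 0# + 0#                      ≈⟨ trans (+-identityʳ _) (zeroʳ a) ⟩
    0#                               ∎

  coeffAlong-single : ∀ {n n'} (F : Monomial n → Monomial n') S M p →
    All (λ e → proj₂ e ≡ M) p → coeffAlong F p S ≈ coef p M * δ (F M) S
  coeffAlong-single F S M [] [] = sym (zeroˡ _)
  coeffAlong-single F S M ((a , .M) ∷ p) (≡.refl ∷ es) = begin
    a * δ (F M) S + coeffAlong F p S         ≈⟨ +-congˡ (coeffAlong-single F S M p es) ⟩
    a * δ (F M) S + coef p M * δ (F M) S      ≈⟨ sym (distribʳ _ a (coef p M)) ⟩
    (a + coef p M) * δ (F M) S               ≈⟨ *-congʳ (+-congʳ (sym a*δMM≈a)) ⟩
    (a * δ M M + coef p M) * δ (F M) S       ∎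
    where
    a*δMM≈a : a * δ M M ≈ a
    a*δMM≈a = trans (reflexive (≡.cong (a *_) (δ-≡ {u = M} ≡.refl))) (*-identityʳ a)

  coeffAlong-filter : ∀ {n n' q} {Q : Carrier × Monomial n → Set q} (Q? : Decidable Q)
    (F : Monomial n → Monomial n') p S →
    coeffAlong F p S ≈ coeffAlong F (filter Q? p) S + coeffAlong F (filter (∁? Q?) p) S
  coeffAlong-filter Q? F [] S = sym (+-identityˡ 0#)
  coeffAlong-filter Q? F ((a , M) ∷ p) S with Q? (a , M)
  ... | yes _ = trans (+-congˡ (coeffAlong-filter Q? F p S)) (sym (+-assoc _ _ _))
  ... | no _ = begin
    x + coeffAlong F p S        ≈⟨ +-congˡ (coeffAlong-filter Q? F p S) ⟩
    x + (yes-part + no-part)    ≈⟨ sym (+-assoc _ _ _) ⟩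
    (x + yes-part) + no-part    ≈⟨ +-congʳ (+-comm _ _) ⟩
    (yes-part + x) + no-part    ≈⟨ +-assoc _ _ _ ⟩
    yes-part + (x + no-part)    ∎
    where
    x = a * δ (F M) S
    yes-part = coeffAlong F (filter Q? p) S
    no-part = coeffAlong F (filter (∁? Q?) p) S

  negate : ∀ {n} → Poly K n → Poly K n
  negate = L.map (λ e → (- proj₁ e , proj₂ e))

  coeffAlong-negate : ∀ {n n'} (F : Monomial n → Monomial n') p S →
                      coeffAlong F (negate p) S ≈ - coeffAlong F p S
  coeffAlong-negate F [] S = sym ε⁻¹≈ε
  coeffAlong-negate F ((a , M) ∷ p) S = begin
    - a * δ (F M) S + coeffAlong F (negate p) S ≈⟨ +-cong (sym (-‿distribˡ-* a _)) (coeffAlong-negate F p S) ⟩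
    - (a * δ (F M) S) + - coeffAlong F p S      ≈⟨ ⁻¹-∙-comm _ _ ⟩
    - (a * δ (F M) S + coeffAlong F p S)        ∎
    where open import Algebra.Properties.Ring ring using (-‿distribˡ-*)

  -- a polynomial with only zero coefficients has zero image under any map
  -- of monomials; by induction on the number of terms, grouping the terms
  -- whose monomial is that of the first term
  image-of-zero : ∀ {n n'} (p : Poly K n) → (∀ m → coef p m ≈ 0#) →
                  ∀ (F : Monomial n → Monomial n') S → coeffAlong F p S ≈ 0#
  image-of-zero p = go p (On.wellFounded length ℕI.<-wellFounded p)
    where
    go : ∀ {n n'} (p : Poly K n) → Acc (λ q r → length q < length r) p → (∀ m → coef p m ≈ 0#) →
         ∀ (F : Monomial n → Monomial n') S → coeffAlong F p S ≈ 0#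
    go [] _ _ F S = refl
    go p@((a , M) ∷ _) (acc shorter) p≋0 F S = begin
      coeffAlong F p S                                  ≈⟨ coeffAlong-filter Q? F p S ⟩
      coeffAlong F same S + coeffAlong F rest S         ≈⟨ +-cong (coeffAlong-single F S M same (AllP.all-filter Q? p)) rest↦0 ⟩
      coef same M * δ (F M) S + 0#                      ≈⟨ +-congʳ (*-congʳ (proj₁ (vanish M))) ⟩
      0# * δ (F M) S + 0#                               ≈⟨ trans (+-identityʳ _) (zeroˡ _) ⟩
      0#                                                ∎
      where
      Q? : Decidable (λ (e : Carrier × Monomial _) → proj₂ e ≡ M)
      Q? e = VP.≡-dec ℕ._≟_ (proj₂ e) M
      same = filter Q? p
      rest = filter (∁? Q?) p
      -- at every monomial, one of the two parts has no term at all
      vanish : ∀ m → coef same m ≈ 0# × coef rest m ≈ 0#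
      vanish m with VP.≡-dec ℕ._≟_ m M
      ... | yes ≡.refl = +-vanishʳ sum≈0 rest≈0 , rest≈0
        where
        sum≈0 = trans (sym (coeffAlong-filter Q? (λ x → x) p m)) (p≋0 m)
        rest≈0 = coeffAlong-vanish (λ x → x) m rest (AllP.all-filter (∁? Q?) p)
      ... | no m≢M = same≈0 , +-vanishˡ sum≈0 same≈0
        where
        sum≈0 = trans (sym (coeffAlong-filter Q? (λ x → x) p m)) (p≋0 m)
        same≈0 = coeffAlong-vanish (λ x → x) m same
                   (All.map (λ e≡M e≡m → m≢M (≡.trans (≡.sym e≡m) e≡M)) (AllP.all-filter Q? p))
      rest↦0 : coeffAlong F rest S ≈ 0#
      rest↦0 = go rest (shorter (LP.filter-notAll (∁? Q?) p (here λ ¬M≡M → ¬M≡M ≡.refl)))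
                 (λ m → proj₂ (vanish m)) F S

  -- coefficientwise equal polynomials have equal images: the difference
  -- p − q has only zero coefficients
  image-cong : ∀ {n n'} (p q : Poly K n) → p ≋ q →
               ∀ (F : Monomial n → Monomial n') S → coeffAlong F p S ≈ coeffAlong F q S
  image-cong p q p≋q F S = x∙y⁻¹≈ε⇒x≈y _ _ (begin
    coeffAlong F p S + - coeffAlong F q S        ≈⟨ +-congˡ (sym (coeffAlong-negate F q S)) ⟩
    coeffAlong F p S + coeffAlong F (negate q) S ≈⟨ sym (coeffAlong-++ F p (negate q) S) ⟩
    coeffAlong F (p ++ negate q) S               ≈⟨ image-of-zero (p ++ negate q) difference≈0 F S ⟩
    0#                                           ∎)
    where
    open import Algebra.Properties.AbelianGroup +-abelianGroup using (x∙y⁻¹≈ε⇒x≈y; x≈y⇒x∙y⁻¹≈ε)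
    difference≈0 : ∀ m → coef (p ++ negate q) m ≈ 0#
    difference≈0 m = trans (coef-++ p (negate q) m)
      (trans (+-congˡ (coeffAlong-negate (λ x → x) q m)) (x≈y⇒x∙y⁻¹≈ε (p≋q m)))

  coef-binomial : ∀ {n} (u v m : Monomial n) → coef (binomial K u v) m ≈ δ u m + - δ v m
  coef-binomial u v m = +-cong (*-identityˡ _) (trans (+-identityʳ _) (-1*x≈-x _))

  coef-binomial-left : ∀ {n} {u v : Monomial n} → u ≢ v → coef (binomial K u v) u ≈ 1#
  coef-binomial-left {u = u} {v} u≢v = begin
    coef (binomial K u v) u ≈⟨ coef-binomial u v u ⟩
    δ u u + - δ v u         ≈⟨ +-cong (reflexive (δ-≡ {u = u} ≡.refl)) (-‿cong (reflexive (δ-≢ (λ e → u≢v (≡.sym e))))) ⟩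
    1# + - 0#               ≈⟨ trans (+-congˡ ε⁻¹≈ε) (+-identityʳ 1#) ⟩
    1#                      ∎

  coef-binomial-right : ∀ {n} {u v : Monomial n} → u ≢ v → coef (binomial K u v) v ≈ - 1#
  coef-binomial-right {u = u} {v} u≢v = begin
    coef (binomial K u v) v ≈⟨ coef-binomial u v v ⟩
    δ u v + - δ v v         ≈⟨ +-cong (reflexive (δ-≢ u≢v)) (-‿cong (reflexive (δ-≡ {u = v} ≡.refl))) ⟩
    0# + - 1#               ≈⟨ +-identityˡ _ ⟩
    - 1#                    ∎

  coef-binomial-other : ∀ {n} {u v m : Monomial n} → u ≢ m → v ≢ m → coef (binomial K u v) m ≈ 0#
  coef-binomial-other {u = u} {v} {m} u≢m v≢m = begin
    coef (binomial K u v) m ≈⟨ coef-binomial u v m ⟩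
    δ u m + - δ v m         ≈⟨ +-cong (reflexive (δ-≢ u≢m)) (-‿cong (reflexive (δ-≢ v≢m))) ⟩
    0# + - 0#               ≈⟨ trans (+-identityˡ _) ε⁻¹≈ε ⟩
    0#                      ∎

  binomial-support : ∀ {n} (u v m : Monomial n) → ¬ (coef (binomial K u v) m ≈ 0#) → m ≡ u ⊎ m ≡ v
  binomial-support u v m nonzero with VP.≡-dec ℕ._≟_ m u | VP.≡-dec ℕ._≟_ m v
  ... | yes m≡u | _ = inj₁ m≡u
  ... | no _ | yes m≡v = inj₂ m≡v
  ... | no m≢u | no m≢v = ⊥-elim (nonzero (coef-binomial-other (λ e → m≢u (≡.sym e)) (λ e → m≢v (≡.sym e))))

  binomial-self : ∀ {n} (u : Monomial n) m → coef (binomial K u u) m ≈ 0#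
  binomial-self u m = trans (coef-binomial u u m) (-‿inverseʳ _)

  binomial-antisym : ∀ {n} (u v m : Monomial n) → coef (binomial K v u) m ≈ - coef (binomial K u v) m
  binomial-antisym u v m = begin
    coef (binomial K v u) m   ≈⟨ coef-binomial v u m ⟩
    δ v m + - δ u m           ≈⟨ sym (⁻¹-anti-homo‿- (δ u m) (δ v m)) ⟩
    - (δ u m + - δ v m)       ≈⟨ -‿cong (sym (coef-binomial u v m)) ⟩
    - coef (binomial K u v) m ∎
    where open import Algebra.Properties.AbelianGroup +-abelianGroup using (⁻¹-anti-homo‿-)

  binomial-trans : ∀ {n} (u v w : Monomial n) → binomial K u w ≋ binomial K u v ++ binomial K v w
  binomial-trans u v w m = begin
    coef (binomial K u w) m                             ≈⟨ coef-binomial u w m ⟩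
    δ u m + - δ w m                                     ≈⟨ +-congʳ (sym (+-identityʳ _)) ⟩
    (δ u m + 0#) + - δ w m                              ≈⟨ +-congʳ (+-congˡ (sym (-‿inverseˡ (δ v m)))) ⟩
    (δ u m + (- δ v m + δ v m)) + - δ w m               ≈⟨ +-congʳ (sym (+-assoc _ _ _)) ⟩
    ((δ u m + - δ v m) + δ v m) + - δ w m               ≈⟨ +-assoc _ _ _ ⟩
    (δ u m + - δ v m) + (δ v m + - δ w m)               ≈⟨ sym (+-cong (coef-binomial u v m) (coef-binomial v w m)) ⟩
    coef (binomial K u v) m + coef (binomial K v w) m   ≈⟨ sym (coef-++ (binomial K u v) (binomial K v w) m) ⟩
    coef (binomial K u v ++ binomial K v w) m           ∎

  -- A polynomial p acts on
  -- coefficient functions h by (p · h)(m) = Σ_{(a,u) ∈ p, u ∣ m} a · h(m / u);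
  -- then coef (p ⊛ q) = p · coef q, and p · (q · h) = (p ⊛ q) · h.

  infixl 7 _⊛_
  _⊛_ : ∀ {n} → Poly K n → Poly K n → Poly K n
  _⊛_ = _*ₚ_ K

  CoeffFun : ℕ → Set c
  CoeffFun n = Monomial n → Carrier

  monomialTimes : ∀ {n} → Monomial n → CoeffFun n → CoeffFun n
  monomialTimes u h m with ∣ₘ? u m
  ... | yes _ = h (m ⊖ u)
  ... | no _ = 0#

  polyTimes : ∀ {n} → Poly K n → CoeffFun n → CoeffFun n
  polyTimes [] h m = 0#
  polyTimes ((a , u) ∷ p) h m = a * monomialTimes u h m + polyTimes p h m

  monomialTimes-cong : ∀ {n} (u : Monomial n) {h h'} → (∀ m → h m ≈ h' m) →
                       ∀ m → monomialTimes u h m ≈ monomialTimes u h' m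
  monomialTimes-cong u h≈h' m with ∣ₘ? u m
  ... | yes _ = h≈h' (m ⊖ u)
  ... | no _ = refl

  monomialTimes-+ : ∀ {n} (u : Monomial n) h h' m →
    monomialTimes u (λ x → h x + h' x) m ≈ monomialTimes u h m + monomialTimes u h' m
  monomialTimes-+ u h h' m with ∣ₘ? u m
  ... | yes _ = refl
  ... | no _ = sym (+-identityˡ 0#)

  monomialTimes-scale : ∀ {n} (u : Monomial n) b h m →
    monomialTimes u (λ x → b * h x) m ≈ b * monomialTimes u h m
  monomialTimes-scale u b h m with ∣ₘ? u m
  ... | yes _ = refl
  ... | no _ = sym (zeroʳ b)

  monomialTimes-yes : ∀ {n} {u m : Monomial n} h → u ∣ₘ m → monomialTimes u h m ≡ h (m ⊖ u)
  monomialTimes-yes {u = u} {m} h u∣m with ∣ₘ? u m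
  ... | yes _ = ≡.refl
  ... | no u∤m = ⊥-elim (u∤m u∣m)

  monomialTimes-no : ∀ {n} {u m : Monomial n} h → ¬ u ∣ₘ m → monomialTimes u h m ≡ 0#
  monomialTimes-no {u = u} {m} h u∤m with ∣ₘ? u m
  ... | yes u∣m = ⊥-elim (u∤m u∣m)
  ... | no _ = ≡.refl

  monomialTimes-0 : ∀ {n} (u m : Monomial n) → monomialTimes u (λ _ → 0#) m ≈ 0#
  monomialTimes-0 u m with ∣ₘ? u m
  ... | yes _ = refl
  ... | no _ = refl

  monomialTimes-⊕ : ∀ {n} (u v : Monomial n) h m →
    monomialTimes (u ⊕ v) h m ≈ monomialTimes u (monomialTimes v h) m
  monomialTimes-⊕ u v h m with ∣ₘ? u m
  ... | no u∤m = reflexive (monomialTimes-no h λ uv∣m → u∤m (∣ₘ-trans (∣ₘ-⊕ u v) uv∣m))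
  ... | yes u∣m with ∣ₘ? v (m ⊖ u)
  ...   | yes v∣m⊖u = reflexive (≡.trans (monomialTimes-yes h (∣ₘ-⊕⁺ u∣m v∣m⊖u)) (≡.cong h (⊖-⊕-assoc m u v)))
  ...   | no v∤m⊖u = reflexive (monomialTimes-no h λ uv∣m → v∤m⊖u (∣ₘ-⊖ uv∣m))

  monomialTimes-δ𝟙 : ∀ {n} (v m : Monomial n) → monomialTimes v (δ 𝟙) m ≡ δ v m
  monomialTimes-δ𝟙 v m with ∣ₘ? v m
  ... | no v∤m = ≡.sym (δ-≢ λ v≡m → v∤m (≡.subst (v ∣ₘ_) v≡m ∣ₘ-refl))
  ... | yes v∣m with VP.≡-dec ℕ._≟_ 𝟙 (m ⊖ v) | VP.≡-dec ℕ._≟_ v m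
  ...   | yes _ | yes _ = ≡.refl
  ...   | no _ | no _ = ≡.refl
  ...   | yes 𝟙≡ | no v≢m = ⊥-elim (v≢m (proj₁ (⊖≡𝟙⇔≡ v∣m) 𝟙≡))
  ...   | no 𝟙≢ | yes v≡m = ⊥-elim (𝟙≢ (proj₂ (⊖≡𝟙⇔≡ v∣m) v≡m))

  polyTimes-cong : ∀ {n} (p : Poly K n) {h h'} → (∀ m → h m ≈ h' m) →
                   ∀ m → polyTimes p h m ≈ polyTimes p h' m
  polyTimes-cong [] h≈h' m = refl
  polyTimes-cong ((a , u) ∷ p) h≈h' m =
    +-cong (*-congˡ (monomialTimes-cong u h≈h' m)) (polyTimes-cong p h≈h' m)

  polyTimes-+ : ∀ {n} (p : Poly K n) h h' m →
    polyTimes p (λ x → h x + h' x) m ≈ polyTimes p h m + polyTimes p h' m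
  polyTimes-+ [] h h' m = sym (+-identityˡ 0#)
  polyTimes-+ ((a , u) ∷ p) h h' m = begin
    a * monomialTimes u (λ x → h x + h' x) m + polyTimes p (λ x → h x + h' x) m
      ≈⟨ +-cong (*-congˡ (monomialTimes-+ u h h' m)) (polyTimes-+ p h h' m) ⟩
    a * (monomialTimes u h m + monomialTimes u h' m) + (polyTimes p h m + polyTimes p h' m)
      ≈⟨ +-congʳ (distribˡ a _ _) ⟩
    (a * monomialTimes u h m + a * monomialTimes u h' m) + (polyTimes p h m + polyTimes p h' m)
      ≈⟨ +-exchangeᴷ _ _ _ _ ⟩
    (a * monomialTimes u h m + polyTimes p h m) + (a * monomialTimes u h' m + polyTimes p h' m) ∎

  polyTimes-0 : ∀ {n} (p : Poly K n) m → polyTimes p (λ _ → 0#) m ≈ 0#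
  polyTimes-0 [] m = refl
  polyTimes-0 ((a , u) ∷ p) m = begin
    a * monomialTimes u (λ _ → 0#) m + polyTimes p (λ _ → 0#) m
      ≈⟨ +-cong (*-congˡ (monomialTimes-0 u m)) (polyTimes-0 p m) ⟩
    a * 0# + 0#  ≈⟨ trans (+-identityʳ _) (zeroʳ a) ⟩
    0#           ∎

  polyTimes-++ : ∀ {n} (p q : Poly K n) h m → polyTimes (p ++ q) h m ≈ polyTimes p h m + polyTimes q h m
  polyTimes-++ [] q h m = sym (+-identityˡ _)
  polyTimes-++ ((a , u) ∷ p) q h m = trans (+-congˡ (polyTimes-++ p q h m)) (sym (+-assoc _ _ _))

  polyTimes-term : ∀ {n} a (u : Monomial n) q h m →
    polyTimes (((a , u) ∷ []) ⊛ q) h m ≈ a * monomialTimes u (polyTimes q h) m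
  polyTimes-term a u [] h m = sym (trans (*-congˡ (monomialTimes-0 u m)) (zeroʳ a))
  polyTimes-term a u ((b , v) ∷ q) h m = begin
    (a * b) * monomialTimes (u ⊕ v) h m + polyTimes (((a , u) ∷ []) ⊛ q) h m
      ≈⟨ +-cong (*-congˡ (monomialTimes-⊕ u v h m)) (polyTimes-term a u q h m) ⟩
    (a * b) * monomialTimes u (monomialTimes v h) m + a * monomialTimes u (polyTimes q h) m
      ≈⟨ +-cong (trans (*-assoc a b _) (*-congˡ (sym (monomialTimes-scale u b _ m)))) refl ⟩
    a * monomialTimes u (λ x → b * monomialTimes v h x) m + a * monomialTimes u (polyTimes q h) m
      ≈⟨ sym (distribˡ a _ _) ⟩
    a * (monomialTimes u (λ x → b * monomialTimes v h x) m + monomialTimes u (polyTimes q h) m)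
      ≈⟨ *-congˡ (sym (monomialTimes-+ u _ _ m)) ⟩
    a * monomialTimes u (polyTimes ((b , v) ∷ q) h) m ∎

  polyTimes-⊛ : ∀ {n} (p q : Poly K n) h m → polyTimes (p ⊛ q) h m ≈ polyTimes p (polyTimes q h) m
  polyTimes-⊛ [] q h m = refl
  polyTimes-⊛ ((a , u) ∷ p) q h m = begin
    polyTimes (firstTerm ++ (p ⊛ q)) h m
      ≈⟨ polyTimes-++ firstTerm (p ⊛ q) h m ⟩
    polyTimes firstTerm h m + polyTimes (p ⊛ q) h m
      ≈⟨ +-cong (sym (trans (polyTimes-++ firstTerm [] h m) (+-identityʳ _))) (polyTimes-⊛ p q h m) ⟩
    polyTimes (((a , u) ∷ []) ⊛ q) h m + polyTimes p (polyTimes q h) m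
      ≈⟨ +-congʳ (polyTimes-term a u q h m) ⟩
    a * monomialTimes u (polyTimes q h) m + polyTimes p (polyTimes q h) m ∎
    where
    firstTerm = L.map (λ { (b , v) → (a * b , zipWith ℕ._+_ u v) }) q

  coef-as-polyTimes : ∀ {n} (q : Poly K n) m → coef q m ≈ polyTimes q (δ 𝟙) m
  coef-as-polyTimes [] m = refl
  coef-as-polyTimes ((b , v) ∷ q) m =
    +-cong (reflexive (≡.cong (b *_) (≡.sym (monomialTimes-δ𝟙 v m)))) (coef-as-polyTimes q m)

  coef-⊛ : ∀ {n} (p q : Poly K n) m → coef (p ⊛ q) m ≈ polyTimes p (coef q) m
  coef-⊛ p q m = begin
    coef (p ⊛ q) m                     ≈⟨ coef-as-polyTimes (p ⊛ q) m ⟩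
    polyTimes (p ⊛ q) (δ 𝟙) m         ≈⟨ polyTimes-⊛ p q (δ 𝟙) m ⟩
    polyTimes p (polyTimes q (δ 𝟙)) m ≈⟨ polyTimes-cong p (λ x → sym (coef-as-polyTimes q x)) m ⟩
    polyTimes p (coef q) m             ∎

  term-times-binomial : ∀ {n} a (t u v : Monomial n) m →
    coef (((a , t) ∷ []) ⊛ binomial K u v) m ≈ a * coef (binomial K (t ⊕ u) (t ⊕ v)) m
  term-times-binomial a t u v m = begin
    (a * 1#) * δ (t ⊕ u) m + ((a * - 1#) * δ (t ⊕ v) m + 0#)
      ≈⟨ +-cong (*-assoc _ _ _) (+-cong (*-assoc _ _ _) (sym (zeroʳ a))) ⟩
    a * (1# * δ (t ⊕ u) m) + (a * (- 1# * δ (t ⊕ v) m) + a * 0#)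
      ≈⟨ +-congˡ (sym (distribˡ a _ _)) ⟩
    a * (1# * δ (t ⊕ u) m) + a * (- 1# * δ (t ⊕ v) m + 0#)
      ≈⟨ sym (distribˡ a _ _) ⟩
    a * coef (binomial K (t ⊕ u) (t ⊕ v)) m ∎

  binomial-shift : ∀ {n} (t u v : Monomial n) → binomial K (t ⊕ u) (t ⊕ v) ≋ ((1# , t) ∷ []) ⊛ binomial K u v
  binomial-shift t u v m = sym (trans (term-times-binomial 1# t u v m) (*-identityˡ _))

  binomial-swap : ∀ {n} (u v : Monomial n) → binomial K v u ≋ ((- 1# , 𝟙) ∷ []) ⊛ binomial K u v
  binomial-swap u v m = begin
    coef (binomial K v u) m                        ≈⟨ binomial-antisym u v m ⟩
    - coef (binomial K u v) m                      ≈⟨ sym (-1*x≈-x _) ⟩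
    - 1# * coef (binomial K u v) m
      ≡⟨ ≡.cong₂ (λ x y → - 1# * coef (binomial K x y) m) (≡.sym (⊕-identityˡ u)) (≡.sym (⊕-identityˡ v)) ⟩
    - 1# * coef (binomial K (𝟙 ⊕ u) (𝟙 ⊕ v)) m     ≈⟨ sym (term-times-binomial (- 1#) 𝟙 u v m) ⟩
    coef (((- 1# , 𝟙) ∷ []) ⊛ binomial K u v) m   ∎

  combination : ∀ {n} → List (Poly K n × Poly K n) → Poly K n
  combination = foldr (λ hg acc → _+ₚ_ K (proj₁ hg ⊛ proj₂ hg) acc) (0ₚ K)

  combination-++ : ∀ {n} (l l' : List (Poly K n × Poly K n)) →
                   combination (l ++ l') ≡ combination l ++ combination l'
  combination-++ [] l' = ≡.refl
  combination-++ ((h , g) ∷ l) l' =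
    ≡.trans (≡.cong ((h ⊛ g) ++_) (combination-++ l l')) (≡.sym (LP.++-assoc (h ⊛ g) (combination l) (combination l')))

  module _ {n ℓ'} {S : Poly K n → Set ℓ'} where

    ideal-cong : ∀ {f f'} → f ≋ f' → InIdeal K S f' → InIdeal K S f
    ideal-cong {f} {f'} f≋f' (l , gens , f'≈) =
      l , gens , ≋⇒≈ₚ f (combination l) λ m → trans (f≋f' m) (≈ₚ⇒≋ f' (combination l) f'≈ m)

    ideal-zero : ∀ {f} → (∀ m → coef f m ≈ 0#) → InIdeal K S f
    ideal-zero {f} f≈0 = [] , [] , ≋⇒≈ₚ f [] f≈0

    ideal-++ : ∀ {f f'} → InIdeal K S f → InIdeal K S f' → InIdeal K S (f ++ f')
    ideal-++ {f} {f'} (l , gens , f≈) (l' , gens' , f'≈) =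
      l ++ l' , AllP.++⁺ gens gens' , ≋⇒≈ₚ (f ++ f') (combination (l ++ l')) λ m → begin
        coef (f ++ f') m                              ≈⟨ coef-++ f f' m ⟩
        coef f m + coef f' m                          ≈⟨ +-cong (≈ₚ⇒≋ f (combination l) f≈ m) (≈ₚ⇒≋ f' (combination l') f'≈ m) ⟩
        coef (combination l) m + coef (combination l') m ≈⟨ sym (coef-++ (combination l) (combination l') m) ⟩
        coef (combination l ++ combination l') m      ≡⟨ ≡.cong (λ q → coef q m) (≡.sym (combination-++ l l')) ⟩
        coef (combination (l ++ l')) m                ∎

    ideal-multiple : ∀ {g} → S g → ∀ h → InIdeal K S (h ⊛ g)
    ideal-multiple {g} g∈S h =
      (h , g) ∷ [] , g∈S ∷ [] , ≋⇒≈ₚ (h ⊛ g) (combination ((h , g) ∷ [])) λ m →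
        sym (trans (coef-++ (h ⊛ g) [] m) (+-identityʳ _))

    -- ⟨S⟩ is closed under multiplication: h · Σ hᵢ gᵢ = Σ (h hᵢ) gᵢ
    ideal-⊛ : ∀ h {f} → InIdeal K S f → InIdeal K S (h ⊛ f)
    ideal-⊛ h {f} (l , gens , f≈) = expand l , AllP.map⁺ gens , ≋⇒≈ₚ (h ⊛ f) (combination (expand l)) λ m → begin
        coef (h ⊛ f) m                     ≈⟨ coef-⊛ h f m ⟩
        polyTimes h (coef f) m             ≈⟨ polyTimes-cong h (≈ₚ⇒≋ f (combination l) f≈) m ⟩
        polyTimes h (coef (combination l)) m ≈⟨ expand-combination l m ⟩
        coef (combination (expand l)) m    ∎
      where
      expand : List (Poly K n × Poly K n) → List (Poly K n × Poly K n)
      expand = L.map (λ hg → (h ⊛ proj₁ hg , proj₂ hg))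

      expand-combination : ∀ l m → polyTimes h (coef (combination l)) m ≈ coef (combination (expand l)) m
      expand-combination [] m = polyTimes-0 h m
      expand-combination ((h' , g) ∷ l) m = begin
        polyTimes h (coef ((h' ⊛ g) ++ combination l)) m
          ≈⟨ polyTimes-cong h (coef-++ (h' ⊛ g) (combination l)) m ⟩
        polyTimes h (λ x → coef (h' ⊛ g) x + coef (combination l) x) m
          ≈⟨ polyTimes-+ h _ _ m ⟩
        polyTimes h (coef (h' ⊛ g)) m + polyTimes h (coef (combination l)) m
          ≈⟨ +-cong (polyTimes-cong h (coef-⊛ h' g) m) (expand-combination l m) ⟩
        polyTimes h (polyTimes h' (coef g)) m + coef (combination (expand l)) m
          ≈⟨ +-congʳ (sym (trans (coef-⊛ (h ⊛ h') g m) (polyTimes-⊛ h h' (coef g) m))) ⟩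
        coef ((h ⊛ h') ⊛ g) m + coef (combination (expand l)) m
          ≈⟨ sym (coef-++ ((h ⊛ h') ⊛ g) (combination (expand l)) m) ⟩
        coef (combination (expand ((h' , g) ∷ l))) m ∎

  ideal-mono : ∀ {n ℓ₁ ℓ₂} {S : Poly K n → Set ℓ₁} {T : Poly K n → Set ℓ₂} →
               (∀ g → S g → InIdeal K T g) → ∀ f → InIdeal K S f → InIdeal K T f
  ideal-mono {S = S} {T} S⊆⟨T⟩ f (l , gens , f≈) =
    ideal-cong {f = f} {combination l} (≈ₚ⇒≋ f (combination l) f≈) (combination∈ l gens)
    where
    combination∈ : ∀ l → All (λ hg → S (proj₂ hg)) l → InIdeal K T (combination l)
    combination∈ [] [] = ideal-zero {f = []} λ m → refl
    combination∈ ((h , g) ∷ l) (g∈S ∷ gens) =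
      ideal-++ {f = h ⊛ g} {f' = combination l} (ideal-⊛ h {f = g} (S⊆⟨T⟩ g g∈S)) (combination∈ l gens)

  ideal-⊆ : ∀ {n ℓ₁ ℓ₂} {S : Poly K n → Set ℓ₁} {T : Poly K n → Set ℓ₂} →
            (∀ g → S g → T g) → ∀ f → InIdeal K S f → InIdeal K T f
  ideal-⊆ S⊆T f (l , gens , f≈) = l , All.map (λ {hg} → S⊆T (proj₂ hg)) gens , f≈

  coeffAlong-shift : ∀ {n n'} T (F : Monomial n → Monomial (suc n')) p S →
    coeffAlong (λ M → shiftT T (F M)) p (shiftT T S) ≡ coeffAlong F p S
  coeffAlong-shift T F p S = coeffAlong-agree _ F _ S p
    (All.tabulate λ {e} _ → δ-injective (shiftT T) (shiftT-injective T) (F (proj₂ e)) S)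

  coeffAlong-shift-low : ∀ {n n'} T (F : Monomial n → Monomial (suc n')) p S → V.head S < T →
    coeffAlong (λ M → shiftT T (F M)) p S ≈ 0#
  coeffAlong-shift-low T F p S S<T =
    coeffAlong-vanish _ S p (All.tabulate λ {e} _ → shiftT-low T (F (proj₂ e)) S S<T)

  shiftP : ∀ {n} → ℕ → Poly K (suc n) → Poly K (suc n)
  shiftP T = L.map (λ e → (proj₁ e , shiftT T (proj₂ e)))

  coeffAlong-shiftP : ∀ {n n'} T (F : Monomial (suc n) → Monomial n') p S →
    coeffAlong F (shiftP T p) S ≡ coeffAlong (λ M → F (shiftT T M)) p S
  coeffAlong-shiftP T F [] S = ≡.refl
  coeffAlong-shiftP T F ((a , M) ∷ p) S = ≡.cong (a * δ (F (shiftT T M)) S +_) (coeffAlong-shiftP T F p S)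

  coef-shiftP : ∀ {n} T (h : Poly K (suc n)) M → coef (shiftP T h) (shiftT T M) ≡ coef h M
  coef-shiftP T h M = ≡.trans (coeffAlong-shiftP T (λ x → x) h (shiftT T M)) (coeffAlong-shift T (λ x → x) h M)

  coef-shiftP-low : ∀ {n} T (h : Poly K (suc n)) y → V.head y < T → coef (shiftP T h) y ≈ 0#
  coef-shiftP-low T h y y<T =
    trans (reflexive (coeffAlong-shiftP T (λ x → x) h y)) (coeffAlong-shift-low T (λ x → x) h y y<T)

module Toric {c ℓ} (K : Field c ℓ) {k d : ℕ} (α : Vec (Vec ℕ d) k) where
  open Field K hiding (zero)
  open Coefficients K

  Mon : Set
  Mon = Monomial (suc k)

  image : Mon → Monomial (suc d)
  image = phiMon K α

  I : Poly K (suc k) → Set ℓ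
  I = ToricIdealH K α

  image-⊕ : ∀ (M N : Mon) → image (M ⊕ N) ≡ image M ⊕ image N
  image-⊕ (e ∷ z) (f ∷ w) = ≡.cong₂ _∷_
    (≡.trans (≡.cong ((e ℕ.+ f) ℕ.+_) (∣⊕∣ z w)) (+-exchange e f ∣ z ∣ₘ ∣ w ∣ₘ)) (lincomb-⊕ z w α)

  image-⊕-cong : ∀ D {M M' : Mon} → image M ≡ image M' → image (D ⊕ M) ≡ image (D ⊕ M')
  image-⊕-cong D {M} {M'} M~M' =
    ≡.trans (image-⊕ D M) (≡.trans (≡.cong (image D ⊕_) M~M') (≡.sym (image-⊕ D M')))

  image-shift : ∀ T (M : Mon) → image (shiftT T M) ≡ shiftT T (image M)
  image-shift T (e ∷ z) = ≡.cong (_∷ lincomb z α) (ℕP.+-assoc T e ∣ z ∣ₘ)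

  I⇒image≈0 : ∀ f → I f → ∀ S → coeffAlong image f S ≈ 0#
  I⇒image≈0 f f∈I S = trans (sym (coeff-phi α f S)) (f∈I S)

  image≈0⇒I : ∀ f → (∀ S → coeffAlong image f S ≈ 0#) → I f
  image≈0⇒I f f↦0 S = trans (coeff-phi α f S) (f↦0 S)

  I-cong : ∀ f f' → f ≋ f' → I f' → I f
  I-cong f f' f≋f' f'∈I = image≈0⇒I f λ S → trans (image-cong f f' f≋f' image S) (I⇒image≈0 f' f'∈I S)

  I-++ : ∀ f f' → I f → I f' → I (f ++ f')
  I-++ f f' f∈I f'∈I = image≈0⇒I (f ++ f') λ S →
    trans (coeffAlong-++ image f f' S) (trans (+-cong (I⇒image≈0 f f∈I S) (I⇒image≈0 f' f'∈I S)) (+-identityˡ 0#))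

  I-binomial : ∀ u v → image u ≡ image v → I (binomial K u v)
  I-binomial u v u~v = image≈0⇒I (binomial K u v) λ S → begin
    1# * δ (image u) S + (- 1# * δ (image v) S + 0#) ≡⟨ ≡.cong (λ x → 1# * δ x S + (- 1# * δ (image v) S + 0#)) u~v ⟩
    coef (binomial K (image v) (image v)) S          ≈⟨ binomial-self (image v) S ⟩
    0#                                               ∎
    where open import Relation.Binary.Reasoning.Setoid setoid

  I-binomial⁻¹ : ∀ u v → I (binomial K u v) → image u ≡ image v
  I-binomial⁻¹ u v b∈I with VP.≡-dec ℕ._≟_ (image u) (image v)
  ... | yes u~v = u~v
  ... | no u≁v = ⊥-elim (1≉0 (trans (sym (coef-binomial-left u≁v)) (I⇒image≈0 (binomial K u v) b∈I (image u))))

  I-shift : ∀ T f → I f → I (shiftP T f)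
  I-shift T f f∈I = image≈0⇒I (shiftP T f) λ S →
    trans (reflexive (≡.trans (coeffAlong-shiftP T image f S)
                              (coeffAlong-agree _ _ S S f (All.tabulate λ {e} _ →
                                 ≡.cong (λ x → δ x S) (image-shift T (proj₂ e))))))
          (shifted-vanishes S)
    where
    shifted-vanishes : ∀ S → coeffAlong (λ M → shiftT T (image M)) f S ≈ 0#
    shifted-vanishes S with T ℕP.≤? V.head S
    ... | no S<T = coeffAlong-shift-low T image f S (ℕP.≰⇒> S<T)
    ... | yes T≤S with shiftT-high T S T≤S
    ...   | S' , ≡.refl = trans (reflexive (coeffAlong-shift T image f S')) (I⇒image≈0 f f∈I S')

module Linking {c ℓ} (K : Field c ℓ) {k : ℕ} (G : List (Poly K (suc k))) where
  open Field K hiding (zero)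
  open Coefficients K

  J : ℕ → Poly K k → Set (c ⊔ ℓ)
  J = JGen K G

  -- y^z ~ⱼ y^w (a record, so that z and w can be inferred)
  record Linked (j : ℕ) (z w : Monomial k) : Set (c ⊔ ℓ) where
    constructor linked
    field in-ideal : InIdeal K (J j) (binomial K z w)

  linked-refl : ∀ {j} z → Linked j z z
  linked-refl z = linked (ideal-zero {f = binomial K z z} (binomial-self z))

  linked-sym : ∀ {j z w} → Linked j z w → Linked j w z
  linked-sym {z = z} {w} (linked z~w) = linked
    (ideal-cong {f = binomial K w z} {f' = ((- 1# , 𝟙) ∷ []) ⊛ binomial K z w} (binomial-swap z w)
      (ideal-⊛ ((- 1# , 𝟙) ∷ []) {f = binomial K z w} z~w))

  linked-trans : ∀ {j z v w} → Linked j z v → Linked j v w → Linked j z w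
  linked-trans {z = z} {v} {w} (linked z~v) (linked v~w) = linked
    (ideal-cong {f = binomial K z w} {f' = binomial K z v ++ binomial K v w} (binomial-trans z v w)
      (ideal-++ {f = binomial K z v} {f' = binomial K v w} z~v v~w))

  linked-generator : ∀ {j} i z w → i ≤ j →
    Σ (Fin (length G)) (λ p → _≈ₚ_ K (L.lookup G p) (binomial K (i ∷ z) (0 ∷ w))) →
    ∀ t → Linked j (t ⊕ z) (t ⊕ w)
  linked-generator {j} i z w i≤j z-w∈G t = linked
    (ideal-cong {f = binomial K (t ⊕ z) (t ⊕ w)} {f' = ((1# , t) ∷ []) ⊛ binomial K z w} (binomial-shift t z w)
      (ideal-multiple {S = J j} (i , z , w , i≤j , z-w∈G , ≡.refl) ((1# , t) ∷ [])))

module GroebnerBasis {c ℓ} (K : Field c ℓ) {k d : ℕ} (α : Vec (Vec ℕ d) k)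
  (σ : Permutation′ k) (G : List (Poly K (suc k)))
  (reducedGB : IsReducedGroebnerBasis K (LexOrder σ) (ToricIdealH K α) G) where

  open Field K hiding (zero)
  open Coefficients K
  open Toric K α
  open MonomialOrder σ
  open import Relation.Binary.Reasoning.Setoid setoid

  IsLeading : Poly K (suc k) → Mon → Set ℓ
  IsLeading = IsLeadingMonomial K _≺_

  leading-nonzero : ∀ f {m} → IsLeading f m → ¬ (coef f m ≈ 0#)
  leading-nonzero f {m} (nonzero , _) coef≈0 = nonzero (trans (coeff≈coef f m) coef≈0)

  above-leading : ∀ f {m M} → IsLeading f m → m ≺ M → coef f M ≈ 0#
  above-leading f {m} {M} (_ , above) m≺M = trans (sym (coeff≈coef f M)) (above M m≺M)

  leading-unique : ∀ f {m m'} → IsLeading f m → IsLeading f m' → m ≡ m'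
  leading-unique f {m} {m'} m-lead m'-lead with VP.≡-dec ℕ._≟_ m m'
  ... | yes m≡m' = m≡m'
  ... | no m≢m' with ≺-total m m' m≢m'
  ...   | inj₁ m≺m' = ⊥-elim (leading-nonzero f m'-lead (above-leading f m-lead m≺m'))
  ...   | inj₂ m'≺m = ⊥-elim (leading-nonzero f m-lead (above-leading f m'-lead m'≺m))

  Index : Set
  Index = Fin (length G)

  g : Index → Poly K (suc k)
  g = L.lookup G

  g∈I : ∀ p → I (g p)
  g∈I p = All.lookup (proj₁ (proj₁ reducedGB)) (∈-lookup p)

  LM : Index → Mon
  LM p = proj₁ (proj₁ (proj₂ reducedGB) p)

  LM-leading : ∀ p → IsLeading (g p) (LM p)
  LM-leading p = proj₁ (proj₂ (proj₁ (proj₂ reducedGB) p))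

  coef-LM : ∀ p → coef (g p) (LM p) ≈ 1#
  coef-LM p = trans (sym (coeff≈coef (g p) (LM p))) (proj₂ (proj₂ (proj₁ (proj₂ reducedGB) p)))

  leading-divisor : ∀ f → I f → ∀ M → ¬ (coef f M ≈ 0#) →
                    Σ Index λ q → Σ Mon λ mf → IsLeading f mf × LM q ∣ₘ mf
  leading-divisor f f∈I M nonzero
    with proj₂ (proj₁ reducedGB) f f∈I (λ f≈0 → nonzero (trans (sym (coeff≈coef f M)) (f≈0 M)))
  ... | q , mg , mf , mg-lead , mf-lead , mg∣mf =
    q , mf , mf-lead , ≡.subst (_∣ₘ mf) (leading-unique (g q) mg-lead (LM-leading q)) mg∣mf

  divisible-term : ∀ p q {M} → ¬ (coef (g p) M ≈ 0#) → LM q ∣ₘ M → q ≡ p × M ≡ LM p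
  divisible-term p q {M} nonzero LMq∣M with q FP.≟ p
  ... | no q≢p = ⊥-elim (proj₂ (proj₂ reducedGB) p q (λ p≡q → q≢p (≡.sym p≡q)) (LM q) (LM-leading q) M
                   (λ coeff≈0 → nonzero (trans (sym (coeff≈coef (g p) M)) coeff≈0)) LMq∣M)
  ... | yes ≡.refl with ∣ₘ⇒≼ LMq∣M
  ...   | inj₁ LM≡M = ≡.refl , ≡.sym LM≡M
  ...   | inj₂ LM≺M = ⊥-elim (nonzero (above-leading (g p) (LM-leading p) LM≺M))

  Standard : Mon → Set
  Standard N = ∀ p → ¬ (LM p ∣ₘ N)

  standard? : ∀ N → Dec (Standard N)
  standard? N = FP.all? (λ p → ¬? (∣ₘ? (LM p) N))

  nonstandard-divisor : ∀ {N} → ¬ Standard N → Σ Index λ p → LM p ∣ₘ N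
  nonstandard-divisor {N} nonstandard with FP.any? (λ p → ∣ₘ? (LM p) N)
  ... | yes divisor = divisor
  ... | no no-divisor = ⊥-elim (nonstandard λ p LMp∣N → no-divisor (p , LMp∣N))

  -- an element of I all of whose monomials are standard is (not nonzero) zero,
  -- since its leading monomial would be divisible by some LM p
  standard-support : ∀ f → I f → (∀ M → ¬ (coef f M ≈ 0#) → Standard M) → ∀ M → ¬ ¬ (coef f M ≈ 0#)
  standard-support f f∈I support M nonzero with leading-divisor f f∈I M nonzero
  ... | q , mf , mf-lead , LMq∣mf = support mf (leading-nonzero f mf-lead) q LMq∣mf

  standard-unique : ∀ {N₁ N₂} → Standard N₁ → Standard N₂ → image N₁ ≡ image N₂ → N₁ ≡ N₂
  standard-unique {N₁} {N₂} N₁-std N₂-std N₁~N₂ with VP.≡-dec ℕ._≟_ N₁ N₂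
  ... | yes N₁≡N₂ = N₁≡N₂
  ... | no N₁≢N₂ = ⊥-elim (standard-support (binomial K N₁ N₂) (I-binomial N₁ N₂ N₁~N₂) support N₁
                     λ coef≈0 → 1≉0 (trans (sym (coef-binomial-left N₁≢N₂)) coef≈0))
    where
    support : ∀ M → ¬ (coef (binomial K N₁ N₂) M ≈ 0#) → Standard M
    support M nonzero with binomial-support N₁ N₂ M nonzero
    ... | inj₁ ≡.refl = N₁-std
    ... | inj₂ ≡.refl = N₂-std

  TwinBelow : Mon → Carrier × Mon → Set
  TwinBelow u e = image (proj₂ e) ≡ image u × proj₂ e ≺ u

  twinBelow? : ∀ u → Decidable (TwinBelow u)
  twinBelow? u e = VP.≡-dec ℕ._≟_ (image (proj₂ e)) (image u) ×-dec ≺? (proj₂ e) u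

  -- Besides its leading monomial u, an element f ∈ I has a smaller term
  -- with the same image: otherwise the coefficient of image u in the image
  -- of f would be the coefficient of u in f, which is nonzero.
  lower-twin : ∀ f u → I f → IsLeading f u → Σ Mon λ M → image M ≡ image u × M ≺ u
  lower-twin f u f∈I u-lead with Any.any? (twinBelow? u) f
  ... | yes twin = proj₂ (proj₁ (Any.satisfied twin)) , proj₂ (Any.satisfied twin)
  ... | no no-twin = ⊥-elim (leading-nonzero f u-lead (begin
      coef f u                                          ≈⟨ coeffAlong-filter Above? (λ x → x) f u ⟩
      coef above u + coef rest u                        ≈⟨ +-congʳ (above≈0 u) ⟩
      0# + coef rest u                                  ≡⟨ ≡.cong (0# +_) (≡.sym rest-image) ⟩
      0# + coeffAlong image rest (image u)              ≈⟨ +-congʳ (sym (image-cong above [] above≈0 image (image u))) ⟩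
      coeffAlong image above (image u) + coeffAlong image rest (image u) ≈⟨ sym (coeffAlong-filter Above? image f (image u)) ⟩
      coeffAlong image f (image u)                      ≈⟨ I⇒image≈0 f f∈I (image u) ⟩
      0#                                                ∎))
    where
    Above? : Decidable (λ (e : Carrier × Mon) → u ≺ proj₂ e)
    Above? e = ≺? u (proj₂ e)
    above = filter Above? f
    rest = filter (∁? Above?) f

    above≈0 : ∀ m → coef above m ≈ 0#
    above≈0 m with ≺? u m
    ... | no u⊀m = coeffAlong-vanish (λ x → x) m above
                     (All.map (λ u≺M M≡m → u⊀m (≡.subst (u ≺_) M≡m u≺M)) (AllP.all-filter Above? f))
    ... | yes u≺m = +-vanishʳ (trans (sym (coeffAlong-filter Above? (λ x → x) f m)) (above-leading f u-lead u≺m))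
                      (coeffAlong-vanish (λ x → x) m rest
                        (All.map (λ u⊀M M≡m → u⊀M (≡.subst (u ≺_) (≡.sym M≡m) u≺m)) (AllP.all-filter (∁? Above?) f)))

    same-test : ∀ {e} → ¬ u ≺ proj₂ e × ¬ TwinBelow u e → δ (image (proj₂ e)) (image u) ≡ δ (proj₂ e) u
    same-test {e} (u⊀M , not-twin) with VP.≡-dec ℕ._≟_ (proj₂ e) u
    ... | yes M≡u = δ-≡ (≡.cong image M≡u)
    ... | no M≢u = δ-≢ image≢
      where
      image≢ : image (proj₂ e) ≢ image u
      image≢ M~u with ≺-total (proj₂ e) u M≢u
      ... | inj₁ M≺u = not-twin (M~u , M≺u)
      ... | inj₂ u≺M = u⊀M u≺M

    rest-image : coeffAlong image rest (image u) ≡ coef rest u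
    rest-image = coeffAlong-agree image (λ x → x) (image u) u rest
      (All.map (λ {e} → same-test {e}) (All.zip (AllP.all-filter (∁? Above?) f ,
                                  AllP.filter⁺ (∁? Above?) (AllP.¬Any⇒All¬ f no-twin))))

  NormalForm : Mon → Set
  NormalForm M = Σ Mon λ N → Standard N × image N ≡ image M

  -- Every monomial has the image of a standard monomial (unique by
  -- standard-unique): divide out some LM p and replace it by a lower twin;
  -- this strictly decreases the monomial.
  normal-form : ∀ M → NormalForm M
  normal-form M = go M (≺-wellFounded M)
    where
    go : ∀ M → Acc _≺_ M → NormalForm M
    go M (acc below) with standard? M
    ... | yes M-std = M , M-std , ≡.refl
    ... | no M-nonstd = replace (nonstandard-divisor M-nonstd)
      where
      replace : Σ Index (λ p → LM p ∣ₘ M) → NormalForm M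
      replace (p , LMp∣M) with lower-twin (g p) (LM p) (g∈I p) (LM-leading p)
      ... | M₀ , M₀~LMp , M₀≺LMp with go (D ⊕ M₀) (below M'≺M)
        where
        D = M ⊖ LM p
        M'≺M : D ⊕ M₀ ≺ M
        M'≺M = ≡.subst (D ⊕ M₀ ≺_) (⊖-⊕ LMp∣M) (≺-⊕ D M₀≺LMp)
      ... | N , N-std , N~M' =
        N , N-std , ≡.trans N~M' (≡.trans (image-⊕-cong (M ⊖ LM p) M₀~LMp) (≡.cong image (⊖-⊕ LMp∣M)))

  -- Constructively, coefficients that are all "not nonzero" need not be
  -- zero.  For h ∈ I they are, given any x^u − x^v ∈ I with u ≠ v: the
  -- polynomial f = t^T h + (x^u − x^v), for T above the t-degrees of u and
  -- v, is nonzero at u, so it has a leading monomial; that monomial has a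
  -- nonzero coefficient, hence is not a multiple t^T M (where f agrees with
  -- h), hence lies below every t^T M.
  ¬¬-vanishing : ∀ h {u v} → I h → (∀ M → ¬ ¬ (coef h M ≈ 0#)) →
                 image u ≡ image v → u ≢ v → ∀ M → coef h M ≈ 0#
  ¬¬-vanishing h {u} {v} h∈I h≈0 u~v u≢v M with leading-divisor f f∈I u f-nonzero-at-u
    where
    T = suc (V.head u ℕ.+ V.head v)
    f = shiftP T h ++ binomial K u v
    f∈I = I-++ (shiftP T h) (binomial K u v) (I-shift T h h∈I) (I-binomial u v u~v)
    f-nonzero-at-u : ¬ (coef f u ≈ 0#)
    f-nonzero-at-u coef≈0 = 1≉0 (begin
      1#                                            ≈⟨ sym (coef-binomial-left u≢v) ⟩
      coef (binomial K u v) u                       ≈⟨ sym (+-identityˡ _) ⟩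
      0# + coef (binomial K u v) u                  ≈⟨ +-congʳ (sym (coef-shiftP-low T h u (s≤s (ℕP.m≤m+n _ _)))) ⟩
      coef (shiftP T h) u + coef (binomial K u v) u ≈⟨ sym (coef-++ (shiftP T h) (binomial K u v) u) ⟩
      coef f u                                      ≈⟨ coef≈0 ⟩
      0#                                            ∎)
  ... | _ , mf , mf-lead , _ = begin
      coef h M                ≈⟨ sym (coef-f-shift M) ⟩
      coef f (shiftT T M)     ≈⟨ above-leading f mf-lead (≺-shiftT T M mf-low) ⟩
      0#                      ∎
    where
    T = suc (V.head u ℕ.+ V.head v)
    f = shiftP T h ++ binomial K u v

    coef-f-shift : ∀ M → coef f (shiftT T M) ≈ coef h M
    coef-f-shift M = begin
      coef f (shiftT T M)                                          ≈⟨ coef-++ (shiftP T h) (binomial K u v) (shiftT T M) ⟩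
      coef (shiftP T h) (shiftT T M) + coef (binomial K u v) (shiftT T M)
        ≈⟨ +-cong (reflexive (coef-shiftP T h M))
                  (coef-binomial-other (λ e → shiftT-low T M u (s≤s (ℕP.m≤m+n _ _)) (≡.sym e))
                                       (λ e → shiftT-low T M v (s≤s (ℕP.m≤n+m _ _)) (≡.sym e))) ⟩
      coef h M + 0#                                                ≈⟨ +-identityʳ _ ⟩
      coef h M                                                     ∎

    mf-low : V.head mf < T
    mf-low with T ℕP.≤? V.head mf
    ... | no T≰mf = ℕP.≰⇒> T≰mf
    ... | yes T≤mf with shiftT-high T mf T≤mf
    ...   | M' , ≡.refl = ⊥-elim (h≈0 M' λ coef≈0 →
              leading-nonzero f mf-lead (trans (coef-f-shift M') coef≈0))

  -- g p = x^{LM p} − x^v, where v is the normal form of a lower twin of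
  -- LM p: h = g p + (x^v − x^{LM p}) lies in I and all its monomials are
  -- standard (by reducedness, apart from LM p, whose coefficient cancels),
  -- so h vanishes.
  generator-is-binomial : ∀ p → Σ Mon λ v → image (LM p) ≡ image v × g p ≋ binomial K (LM p) v
  generator-is-binomial p with lower-twin (g p) (LM p) (g∈I p) (LM-leading p)
  ... | M₀ , M₀~u , _ with normal-form M₀
  ...   | v , v-std , v~M₀ = v , ≡.sym v~u , g≋binomial
    where
    u = LM p
    v~u = ≡.trans v~M₀ M₀~u

    v≢u : v ≢ u
    v≢u v≡u = v-std p (≡.subst (u ∣ₘ_) (≡.sym v≡u) ∣ₘ-refl)

    h = g p ++ binomial K v u
    h∈I = I-++ (g p) (binomial K v u) (g∈I p) (I-binomial v u v~u)

    support-standard : ∀ M → ¬ (coef h M ≈ 0#) → Standard M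
    support-standard M nonzero with VP.≡-dec ℕ._≟_ M u | VP.≡-dec ℕ._≟_ M v
    ... | yes ≡.refl | _ = ⊥-elim (nonzero (begin
      coef h u                                 ≈⟨ coef-++ (g p) (binomial K v u) u ⟩
      coef (g p) u + coef (binomial K v u) u   ≈⟨ +-cong (coef-LM p) (coef-binomial-right v≢u) ⟩
      1# + - 1#                                ≈⟨ -‿inverseʳ 1# ⟩
      0#                                       ∎))
    ... | no _ | yes ≡.refl = v-std
    ... | no M≢u | no M≢v = λ q LMq∣M → M≢u (proj₂ (divisible-term p q g-nonzero LMq∣M))
      where
      g-nonzero : ¬ (coef (g p) M ≈ 0#)
      g-nonzero coef≈0 = nonzero (begin
        coef h M                                 ≈⟨ coef-++ (g p) (binomial K v u) M ⟩
        coef (g p) M + coef (binomial K v u) M   ≈⟨ +-cong coef≈0 (coef-binomial-other (λ e → M≢v (≡.sym e)) (λ e → M≢u (≡.sym e))) ⟩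
        0# + 0#                                  ≈⟨ +-identityˡ 0# ⟩
        0#                                       ∎)

    h≈0 : ∀ M → coef h M ≈ 0#
    h≈0 = ¬¬-vanishing h h∈I (standard-support h h∈I support-standard) v~u v≢u

    g≋binomial : g p ≋ binomial K u v
    g≋binomial m = begin
      coef (g p) m              ≈⟨ inverseˡ-unique _ _ (trans (sym (coef-++ (g p) (binomial K v u) m)) (h≈0 m)) ⟩
      - coef (binomial K v u) m ≈⟨ sym (binomial-antisym v u m) ⟩
      coef (binomial K u v) m   ∎
      where open import Algebra.Properties.AbelianGroup +-abelianGroup using (inverseˡ-unique)

  -- the trailing monomial of g p = x^u − x^v lies below u, as its
  -- coefficient −1 is nonzero
  trailing-below : ∀ p {v} → g p ≋ binomial K (LM p) v → v ≺ LM p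
  trailing-below p {v} g≋b with VP.≡-dec ℕ._≟_ v (LM p)
  ... | yes v≡u = ⊥-elim (1≉0 (begin
        1#                              ≈⟨ sym (coef-LM p) ⟩
        coef (g p) (LM p)               ≈⟨ g≋b (LM p) ⟩
        coef (binomial K (LM p) v) (LM p) ≡⟨ ≡.cong (λ x → coef (binomial K (LM p) x) (LM p)) v≡u ⟩
        coef (binomial K (LM p) (LM p)) (LM p) ≈⟨ binomial-self (LM p) (LM p) ⟩
        0#                              ∎))
  ... | no v≢u with ≺-total v (LM p) v≢u
  ...   | inj₁ v≺u = v≺u
  ...   | inj₂ u≺v = ⊥-elim (-1≉0 (begin
        - 1#                       ≈⟨ sym (coef-binomial-right (λ e → v≢u (≡.sym e))) ⟩
        coef (binomial K (LM p) v) v ≈⟨ sym (g≋b v) ⟩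
        coef (g p) v               ≈⟨ above-leading (g p) (LM-leading p) u≺v ⟩
        0#                         ∎))

  -- The trailing monomial v of g p = x^u − x^v is free of t.  It cannot
  -- be divisible by t while u is not, as v ≺ u; and if t divided both,
  -- x^{u/t} − x^{v/t} ∈ I would have a leading monomial divisible by some
  -- LM q, which then divides u or v, contradicting reducedness.
  trailing-t-free : ∀ p u v → LM p ≡ u → g p ≋ binomial K u v → image u ≡ image v → v ≺ u → V.head v ≡ 0
  trailing-t-free p u (zero ∷ w) _ _ _ _ = ≡.refl
  trailing-t-free p (zero ∷ z) (suc e ∷ w) _ _ _ v≺u =
    ⊥-elim (≺-irrefl {suc e ∷ w} (≺-trans {suc e ∷ w} {0 ∷ z} {suc e ∷ w} v≺u (≺-byT {u = z} {v = w} (s≤s z≤n))))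
  trailing-t-free p (suc i ∷ z) (suc e ∷ w) LM≡u g≋b u~v v≺u
    with leading-divisor (binomial K (i ∷ z) (e ∷ w)) (I-binomial (i ∷ z) (e ∷ w) u'~v') (i ∷ z)
           (λ coef≈0 → 1≉0 (trans (sym (coef-binomial-left u'≢v')) coef≈0))
    where
    u'~v' : image (i ∷ z) ≡ image (e ∷ w)
    u'~v' with VP.∷-injective u~v
    ... | degrees , lincombs = ≡.cong₂ _∷_ (ℕP.suc-injective degrees) lincombs
    u'≢v' : (i ∷ z) ≢ (e ∷ w)
    u'≢v' ≡.refl = ≺-irrefl {suc i ∷ z} v≺u
  ... | q , mf , mf-lead , LMq∣mf
    with binomial-support (i ∷ z) (e ∷ w) mf (leading-nonzero (binomial K (i ∷ z) (e ∷ w)) mf-lead)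
  ...   | inj₁ ≡.refl with divisible-term p q g-nonzero-at-u (∣ₘ-trans LMq∣mf (t∣ i z))
    where
    g-nonzero-at-u : ¬ (coef (g p) (suc i ∷ z) ≈ 0#)
    g-nonzero-at-u coef≈0 = 1≉0 (trans (sym (coef-LM p)) (≡.subst (λ x → coef (g p) x ≈ 0#) (≡.sym LM≡u) coef≈0))
  ...     | ≡.refl , _ = ⊥-elim (ℕP.<-irrefl ≡.refl (PW.head (≡.subst (_∣ₘ (i ∷ z)) LM≡u LMq∣mf)))
  trailing-t-free p (suc i ∷ z) (suc e ∷ w) LM≡u g≋b u~v v≺u | q , mf , mf-lead , LMq∣mf | inj₂ ≡.refl
    with divisible-term p q g-nonzero-at-v (∣ₘ-trans LMq∣mf (t∣ e w))
    where
    g-nonzero-at-v : ¬ (coef (g p) (suc e ∷ w) ≈ 0#)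
    g-nonzero-at-v coef≈0 = -1≉0 (trans (sym (coef-binomial-right u≢v)) (trans (sym (g≋b (suc e ∷ w))) coef≈0))
      where
      u≢v : (suc i ∷ z) ≢ (suc e ∷ w)
      u≢v u≡v = ≺-irrefl {suc i ∷ z} (≡.subst (_≺ (suc i ∷ z)) (≡.sym u≡v) v≺u)
  ... | _ , v≡LM = ⊥-elim (≺-irrefl {suc i ∷ z} (≡.subst (_≺ (suc i ∷ z)) (≡.trans v≡LM LM≡u) v≺u))

  record GeneratorShape (p : Index) : Set ℓ where
    field
      i : ℕ
      z w : Monomial k
      leading≡ : LM p ≡ i ∷ z
      binomial≋ : g p ≋ binomial K (i ∷ z) (0 ∷ w)
      same-image : image (i ∷ z) ≡ image (0 ∷ w)
      trailing≺ : 0 ∷ w ≺ i ∷ z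

  generator-shape : ∀ p → GeneratorShape p
  generator-shape p = shape (LM p) v ≡.refl g≋b u~v (trailing-below p g≋b)
    where
    v = proj₁ (generator-is-binomial p)
    u~v = proj₁ (proj₂ (generator-is-binomial p))
    g≋b = proj₂ (proj₂ (generator-is-binomial p))
    shape : ∀ u v → LM p ≡ u → g p ≋ binomial K u v → image u ≡ image v → v ≺ u → GeneratorShape p
    shape (i ∷ z) (zero ∷ w) LM≡u g≋b u~v v≺u = record
      { i = i ; z = z ; w = w ; leading≡ = LM≡u ; binomial≋ = g≋b ; same-image = u~v ; trailing≺ = v≺u }
    shape (i ∷ z) (suc e ∷ w) LM≡u g≋b u~v v≺u =
      ⊥-elim (ℕP.1+n≢0 (trailing-t-free p (i ∷ z) (suc e ∷ w) LM≡u g≋b u~v v≺u))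

  open Linking K G

  -- Reducing M to its standard normal form N links the y-parts of M and N
  -- in ⟨J_j⟩ once j is at least the t-degree of M: each reduction step
  -- replaces a factor t^i y^z = LM p by y^w, where i ≤ t-degree of M.
  linked-to-normal-form : ∀ M N → Standard N → image N ≡ image M →
                          ∀ j → V.head M ≤ j → Linked j (V.tail M) (V.tail N)
  linked-to-normal-form M = go M (≺-wellFounded M)
    where
    go : ∀ M → Acc _≺_ M → ∀ N → Standard N → image N ≡ image M →
         ∀ j → V.head M ≤ j → Linked j (V.tail M) (V.tail N)
    go M (acc below) N N-std N~M j M≤j with standard? M
    ... | yes M-std = ≡.subst (λ X → Linked j (V.tail M) (V.tail X))
                        (standard-unique M-std N-std (≡.sym N~M)) (linked-refl (V.tail M))
    ... | no M-nonstd = reduce (nonstandard-divisor M-nonstd)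
      where
      reduce : Σ Index (λ p → LM p ∣ₘ M) → Linked j (V.tail M) (V.tail N)
      reduce (p , LMp∣M) =
        ≡.subst (λ X → V.head X ≤ j → Linked j (V.tail X) (V.tail N)) M≡
          (step D (go (D ⊕ (0 ∷ w)) (below reduced≺M) N N-std N~reduced j)) M≤j
        where
        open GeneratorShape (generator-shape p)
        D = M ⊖ LM p

        M≡ : D ⊕ (i ∷ z) ≡ M
        M≡ = ≡.subst (λ u → D ⊕ u ≡ M) leading≡ (⊖-⊕ LMp∣M)

        reduced≺M : D ⊕ (0 ∷ w) ≺ M
        reduced≺M = ≡.subst (D ⊕ (0 ∷ w) ≺_) M≡ (≺-⊕ D trailing≺)

        N~reduced : image N ≡ image (D ⊕ (0 ∷ w))
        N~reduced = ≡.trans N~M (≡.trans (≡.cong image (≡.sym M≡)) (image-⊕-cong D same-image))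

        step : ∀ D → (V.head (D ⊕ (0 ∷ w)) ≤ j → Linked j (V.tail (D ⊕ (0 ∷ w))) (V.tail N)) →
               V.head (D ⊕ (i ∷ z)) ≤ j → Linked j (V.tail (D ⊕ (i ∷ z))) (V.tail N)
        step (dh ∷ dt) reduced-linked dh+i≤j = linked-trans
          (linked-generator i z w (ℕP.≤-trans (ℕP.m≤n+m i dh) dh+i≤j) (p , ≋⇒≈ₚ (g p) (binomial K (i ∷ z) (0 ∷ w)) binomial≋) dt)
          (reduced-linked (ℕP.≤-trans (ℕP.+-monoʳ-≤ dh z≤n) dh+i≤j))

  -- if t^m y^z and y^w (m ≤ j) have the same image, they have the same
  -- normal form N, and both y^z and y^w are linked to the y-part of N
  linked-by-image : ∀ j m z w → m ≤ j → image (m ∷ z) ≡ image (0 ∷ w) → Linked j z w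
  linked-by-image j m z w m≤j same-image =
    let (N , N-std , N~w) = normal-form (0 ∷ w) in
    linked-trans (linked-to-normal-form (m ∷ z) N N-std (≡.trans N~w (≡.sym same-image)) j m≤j)
                 (linked-sym (linked-to-normal-form (0 ∷ w) N N-std N~w j z≤n))

  factorizations-linked : ∀ j {γ} z w → IsFactorization α z γ → IsFactorization α w γ →
                          ∣ ∣ w ∣ₘ - ∣ z ∣ₘ ∣ ≤ j → Linked j z w
  factorizations-linked j z w z∈Z w∈Z gap≤j with ℕP.≤-total ∣ z ∣ₘ ∣ w ∣ₘ
  ... | inj₁ z≤w = linked-by-image j _ z w
        (≡.subst (_≤ j) (ℕP.m≤n⇒∣n-m∣≡n∸m z≤w) gap≤j)
        (≡.cong₂ _∷_ (ℕP.m∸n+n≡m z≤w) (≡.trans z∈Z (≡.sym w∈Z)))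
  ... | inj₂ w≤z = linked-sym (linked-by-image j _ w z
        (≡.subst (_≤ j) (≡.trans (ℕP.∣-∣-comm ∣ w ∣ₘ ∣ z ∣ₘ) (ℕP.m≤n⇒∣n-m∣≡n∸m w≤z)) gap≤j)
        (≡.cong₂ _∷_ (ℕP.m∸n+n≡m w≤z) (≡.trans w∈Z (≡.sym z∈Z))))

  I⊆⟨J⟩ : ∀ j f → IGen K α j f → InIdeal K (J j) f
  I⊆⟨J⟩ j f (γ , z , w , z∈Z , w∈Z , gap≤j , ≡.refl) = Linked.in-ideal (factorizations-linked j z w z∈Z w∈Z gap≤j)

  -- J_j ⊆ I_j on generators: t^i y^z − y^w ∈ G ⊆ I forces i + |z| = |w|
  -- and Σ zᵢαᵢ = Σ wᵢαᵢ
  J⊆I : ∀ j f → J j f → IGen K α j f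
  J⊆I j f (i , z , w , i≤j , (p , g≈b) , ≡.refl) = lincomb z α , z , w , ≡.refl , ≡.sym lincombs , gap≤j , ≡.refl
    where
    b∈I : I (binomial K (i ∷ z) (0 ∷ w))
    b∈I = I-cong (binomial K (i ∷ z) (0 ∷ w)) (g p)
            (λ m → sym (≈ₚ⇒≋ (g p) (binomial K (i ∷ z) (0 ∷ w)) g≈b m)) (g∈I p)
    degrees : i ℕ.+ ∣ z ∣ₘ ≡ ∣ w ∣ₘ
    degrees = VP.∷-injectiveˡ (I-binomial⁻¹ (i ∷ z) (0 ∷ w) b∈I)
    lincombs : lincomb z α ≡ lincomb w α
    lincombs = VP.∷-injectiveʳ (I-binomial⁻¹ (i ∷ z) (0 ∷ w) b∈I)

    gap≤j : ∣ ∣ w ∣ₘ - ∣ z ∣ₘ ∣ ≤ j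
    gap≤j = ≡.subst (_≤ j) (≡.sym (≡.trans (≡.cong ∣_- ∣ z ∣ₘ ∣ (≡.sym degrees)) (∣i+m-m∣≡i i ∣ z ∣ₘ))) i≤j

theorem3p10 : ∀ {c ℓ} (K : Field c ℓ) (k d : ℕ) (α : Vec (Vec ℕ d) k) →
    MinimalGenerators α →
    (σ : Permutation′ k) (G : List (Poly K (suc k))) →
    IsReducedGroebnerBasis K (LexOrder σ) (ToricIdealH K α) G →
    ∀ (j : ℕ) → SameIdeal K (IGen K α j) (JGen K G j)
theorem3p10 K k d α _ σ G reducedGB j f =
  Coefficients.ideal-mono K (I⊆⟨J⟩ j) f , Coefficients.ideal-⊆ K (J⊆I j) f
  where open GroebnerBasis K α σ G reducedGB
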